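{- Let $X$ be a nonempty totally ordered set, $s\geq1$ an integer, and $L$ the set of all Lyndon words in $X^*$ of length $s$. Let $r$ be a positive integer all of whose prime factors are larger than $s$. Then $\mathrm{Sh}(X)_{\mathrm{indec},s}\otimes(\mathbb{Z}/r)=\mathrm{Sh}(X)^{(L)}_{\mathrm{indec},s}\otimes(\mathbb{Z}/r)$; that is, the elements $\bar w\otimes1$, $w\in L$, span $\mathrm{Sh}(X)_{\mathrm{indec},s}\otimes(\mathbb{Z}/r)$.
   Context: $X^*$ is the free monoid of words on $X$, $|w|$ the length, $\leq_{\mathrm{alp}}$ the lexicographic order. A Lyndon word is a nonempty word strictly $\leq_{\mathrm{alp}}$-smaller than all its proper nonempty suffixes. The shuffle product of $u=(x_1\cdots x_r)$ and $v=(x_{r+1}\cdots x_{r+t})$ is $u ш v=\sum_\sigma(x_{\sigma^{ -1}(1)}\cdots x_{\sigma^{ -1}(r+t)})$, summing over permutations $\sigma$ of $\{1,\dots,r+t\}$ with $\sigma(1)<\dots<\sigma(r)$ and $\sigma(r+1)<\dots<\sigma(r+t)$. $\mathrm{Sh}(X)$ is the free $\mathbb{Z}$-module on $X^*$ with the bilinearly extended shuffle product, graded by length. $\mathrm{Sh}(X)_{\mathrm{indec}}$ is the quotient by the submodule generated by all $u ш v$ with $u,v$ nonempty; $\mathrm{Sh}(X)_{\mathrm{indec},s}$ is its degree-$s$ component, $\bar w$ the image of a word $w$, and $\mathrm{Sh}(X)^{(L)}_{\mathrm{indec},s}$ the submodule generated by the $\bar w$, $w\in L$. -}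

module Defs where

open import Level using (Level)
open import Data.Nat using (ℕ)
open import Data.Integer using (ℤ; _+_; _*_) renaming (+_ to ℤ+_)
open import Data.Product using (_×_; _,_; Σ-syntax)
open import Data.List using (List; []; _∷_; _++_; map; concatMap; length)
open import Data.List.Properties using (≡-dec)
open import Relation.Binary.Core using (Rel)
open import Relation.Binary.Structures using (IsStrictTotalOrder)
open import Relation.Binary.PropositionalEquality using (_≡_)
open import Relation.Nullary using (yes; no)
open import Data.List.Relation.Binary.Lex.Strict using (Lex-<)

module Sh {a ℓ : Level} {X : Set a} {_<_ : Rel X ℓ}
          (sto : IsStrictTotalOrder _≡_ _<_) where

  open IsStrictTotalOrder sto using (_≟_)

  Word : Set a
  Word = List X

  -- lexicographic (alphabetic) strict order on words: a proper prefix is smaller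
  _<alp_ : Word → Word → Set (a Level.⊔ ℓ)
  _<alp_ = Lex-< _≡_ _<_

  NonEmpty : Word → Set a
  NonEmpty u = Σ[ x ∈ X ] Σ[ u' ∈ Word ] u ≡ x ∷ u'

  Lyndon : Word → Set (a Level.⊔ ℓ)
  Lyndon w = NonEmpty w
           × (∀ (u v : Word) → w ≡ u ++ v → NonEmpty u → NonEmpty v → w <alp v)

  -- the shuffle product of two words, as the list (multiset) of the words
  -- occurring in u ш v, each listed with its multiplicity
  shuffle : Word → Word → List Word
  shuffle []       v        = v ∷ []
  shuffle (x ∷ u)  []       = (x ∷ u) ∷ []
  shuffle (x ∷ u)  (y ∷ v)  = map (x ∷_) (shuffle u (y ∷ v))
                             ++ map (y ∷_) (shuffle (x ∷ u) v)

  -- elements of the free ℤ-module Sh(X) on X*, as finite formal sums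
  FreeZ : Set a
  FreeZ = List (ℤ × Word)

  coeff : FreeZ → Word → ℤ
  coeff []             w = ℤ+ 0
  coeff ((c , v) ∷ f)  w with ≡-dec _≟_ v w
  ... | yes _ = c + coeff f w
  ... | no  _ = coeff f w

  _≈_ : FreeZ → FreeZ → Set a
  f ≈ g = ∀ w → coeff f w ≡ coeff g w

  _·_ : ℤ → FreeZ → FreeZ
  c · f = map (λ { (d , w) → (c * d , w) }) f

  sh : Word → Word → FreeZ
  sh u v = map (λ w → (ℤ+ 1 , w)) (shuffle u v)

  shSum : List (ℤ × Word × Word) → FreeZ
  shSum = concatMap (λ { (d , u , v) → d · sh u v })

{-# OPTIONS --safe #-}

module Submission where

-- A word w of length s that is not Lyndon is, modulo shuffles of nonempty words and modulo r,
-- an integer combination of lexicographically smaller words of length s; induction on the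
-- lexicographic order (over the finitely many letters of w) then gives the claim. Duval's
-- factorisation writes such a w as p V with p Lyndon, V nonempty and V bounded by the periodic
-- word p^ω. Then w is the largest term of p ш V: a term equals w only when p is re-inserted at a
-- multiple of its period, otherwise the Lyndon property of p makes it smaller. Hence w occurs in
-- p ш V with a multiplicity 1 ≤ N ≤ |V| + 1 ≤ s, so N is prime to r, α N + β r = 1 for some
-- integers α, β, and w = α (p ш V) − α (smaller terms) + r β w.

open import Level using (Level; _⊔_)
open import Relation.Binary.Core using (Rel)
open import Relation.Binary.Structures using (IsStrictTotalOrder)
open import Relation.Binary.PropositionalEquality

module ListLemmas {a : Level} {A : Set a} where

  open import Data.Nat using (ℕ; zero; suc; _+_; _≤_; _<_; z≤n; s≤s)
  open import Data.List using (List; []; _∷_; _++_; map; length; take; drop)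
  open import Data.List.Properties using (++-assoc)

  at : List A → ℕ → A → A
  at [] n d = d
  at (y ∷ ys) zero d = y
  at (y ∷ ys) (suc n) d = at ys n d

  at-drop : ∀ (xs : List A) f d z → at (drop f xs) d z ≡ at xs (f + d) z
  at-drop [] zero d z = refl
  at-drop [] (suc f) d z = refl
  at-drop (x ∷ xs) zero d z = refl
  at-drop (x ∷ xs) (suc f) d z = at-drop xs f d z

  drop-at : ∀ (xs : List A) f z → f < length xs → drop f xs ≡ at xs f z ∷ drop (suc f) xs
  drop-at (x ∷ xs) zero z _ = refl
  drop-at (x ∷ xs) (suc f) z (s≤s h) = drop-at xs f z h

  take-++ˡ : ∀ (xs ys : List A) {n} → n ≤ length xs → take n (xs ++ ys) ≡ take n xs
  take-++ˡ xs ys {zero} _ = refl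
  take-++ˡ (x ∷ xs) ys {suc n} (s≤s le) = cong (x ∷_) (take-++ˡ xs ys le)

  drop-++ˡ : ∀ (xs ys : List A) {n} → n ≤ length xs → drop n (xs ++ ys) ≡ drop n xs ++ ys
  drop-++ˡ xs ys {zero} _ = refl
  drop-++ˡ (x ∷ xs) ys {suc n} (s≤s le) = drop-++ˡ xs ys le

  drop-++-length : ∀ (xs ys : List A) {n} → length xs ≡ n → drop n (xs ++ ys) ≡ ys
  drop-++-length [] ys refl = refl
  drop-++-length (x ∷ xs) ys refl = drop-++-length xs ys refl

  take-++-length : ∀ (xs ys : List A) {k} n → length xs ≡ k → take (k + n) (xs ++ ys) ≡ xs ++ take n ys
  take-++-length [] ys n refl = refl
  take-++-length (x ∷ xs) ys n refl = cong (x ∷_) (take-++-length xs ys n refl)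

  <-length-drop : ∀ j d (xs : List A) → j + d < length xs → d < length (drop j xs)
  <-length-drop zero d xs h = h
  <-length-drop (suc j) d (x ∷ xs) (s≤s h) = <-length-drop j d xs h

  length-take-≤ : ∀ n (xs : List A) → n ≤ length xs → length (take n xs) ≡ n
  length-take-≤ zero xs _ = refl
  length-take-≤ (suc n) (x ∷ xs) (s≤s le) = cong suc (length-take-≤ n xs le)

  drop-≡-∷⇒drop-suc : ∀ j (xs : List A) {y q} → drop j xs ≡ y ∷ q → drop (suc j) xs ≡ q
  drop-≡-∷⇒drop-suc zero (x ∷ xs) refl = refl
  drop-≡-∷⇒drop-suc (suc j) (x ∷ xs) e = drop-≡-∷⇒drop-suc j xs e

  drop-≡-∷⇒< : ∀ j (xs : List A) {y q} → drop j xs ≡ y ∷ q → j < length xs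
  drop-≡-∷⇒< zero (x ∷ xs) e = s≤s z≤n
  drop-≡-∷⇒< (suc j) (x ∷ xs) e = s≤s (drop-≡-∷⇒< j xs e)

  drop-≡-∷⇒take-suc : ∀ j (xs : List A) {y q} → drop j xs ≡ y ∷ q → take (suc j) xs ≡ take j xs ++ y ∷ []
  drop-≡-∷⇒take-suc zero (x ∷ xs) refl = refl
  drop-≡-∷⇒take-suc (suc j) (x ∷ xs) e = cong (x ∷_) (drop-≡-∷⇒take-suc j xs e)

  map-++-∷ : ∀ (P : List A) y (S : List (List A)) → map (P ++_) (map (y ∷_) S) ≡ map ((P ++ y ∷ []) ++_) S
  map-++-∷ P y [] = refl
  map-++-∷ P y (t ∷ S) = cong₂ _∷_ (sym (++-assoc P (y ∷ []) t)) (map-++-∷ P y S)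

module WordOrder {a ℓ : Level} {X : Set a} {_⊏_ : Rel X ℓ}
                 (sto : IsStrictTotalOrder _≡_ _⊏_) where

  open import Defs
  open import Data.Nat using (ℕ; zero; suc; _+_; _≤_; z≤n; s≤s)
  open import Data.Nat.Properties using (+-suc; suc-injective)
  open import Data.Product using (_×_; _,_; Σ-syntax)
  open import Data.Sum using (_⊎_; inj₁; inj₂)
  open import Data.Empty using (⊥-elim)
  open import Data.List using (List; []; _∷_; _++_; map; length; take)
  open import Data.List.Properties using (≡-dec; ++-cancelˡ)
  open import Data.List.Relation.Unary.All using (All; []; _∷_)
  import Data.List.Relation.Unary.All.Properties as All
  open import Data.List.Membership.Propositional using (_∈_)
  open import Data.List.Relation.Binary.Lex.Core using (this; next)
  open import Data.List.Relation.Binary.Lex.Strict using (Lex-<)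
  open import Relation.Binary.Definitions using (tri<; tri≈; tri>)
  open import Relation.Nullary using (¬_; yes; no)

  open IsStrictTotalOrder sto using (compare; _≟_) renaming (irrefl to ⊏-irrefl; trans to ⊏-trans)
  open Sh sto using (Word; shuffle)

  infix 4 _≺_ _≼_
  data _≺_ : Word → Word → Set (a ⊔ ℓ) where
    ≺-head : ∀ {x y xs ys} → x ⊏ y → (x ∷ xs) ≺ (y ∷ ys)
    ≺-tail : ∀ {x xs ys} → xs ≺ ys → (x ∷ xs) ≺ (x ∷ ys)

  _≼_ : Word → Word → Set (a ⊔ ℓ)
  xs ≼ ys = xs ≡ ys ⊎ xs ≺ ys

  ≺-irrefl : ∀ {xs} → ¬ (xs ≺ xs)
  ≺-irrefl (≺-head p) = ⊏-irrefl refl p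
  ≺-irrefl (≺-tail p) = ≺-irrefl p

  ≺-trans : ∀ {xs ys zs} → xs ≺ ys → ys ≺ zs → xs ≺ zs
  ≺-trans (≺-head p) (≺-head q) = ≺-head (⊏-trans p q)
  ≺-trans (≺-head p) (≺-tail q) = ≺-head p
  ≺-trans (≺-tail p) (≺-head q) = ≺-head q
  ≺-trans (≺-tail p) (≺-tail q) = ≺-tail (≺-trans p q)

  ≼-≺-trans : ∀ {xs ys zs} → xs ≼ ys → ys ≺ zs → xs ≺ zs
  ≼-≺-trans (inj₁ refl) q = q
  ≼-≺-trans (inj₂ p) q = ≺-trans p q

  ≺-≼-trans : ∀ {xs ys zs} → xs ≺ ys → ys ≼ zs → xs ≺ zs
  ≺-≼-trans p (inj₁ refl) = p
  ≺-≼-trans p (inj₂ q) = ≺-trans p q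

  ≼-trans : ∀ {xs ys zs} → xs ≼ ys → ys ≼ zs → xs ≼ zs
  ≼-trans (inj₁ refl) q = q
  ≼-trans (inj₂ p) q = inj₂ (≺-≼-trans p q)

  ∷-≼ : ∀ {x xs ys} → xs ≼ ys → (x ∷ xs) ≼ (x ∷ ys)
  ∷-≼ (inj₁ refl) = inj₁ refl
  ∷-≼ (inj₂ p) = inj₂ (≺-tail p)

  ++-≺ : ∀ zs {xs ys} → xs ≺ ys → (zs ++ xs) ≺ (zs ++ ys)
  ++-≺ [] p = p
  ++-≺ (z ∷ zs) p = ≺-tail (++-≺ zs p)

  ++-≼ : ∀ zs {xs ys} → xs ≼ ys → (zs ++ xs) ≼ (zs ++ ys)
  ++-≼ zs (inj₁ refl) = inj₁ refl
  ++-≼ zs (inj₂ p) = inj₂ (++-≺ zs p)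

  ≺-take⁻ : ∀ n {xs ys} → take n xs ≺ take n ys → xs ≺ ys
  ≺-take⁻ (suc n) {x ∷ xs} {y ∷ ys} (≺-head p) = ≺-head p
  ≺-take⁻ (suc n) {x ∷ xs} {.x ∷ ys} (≺-tail p) = ≺-tail (≺-take⁻ n p)

  ≺-take⁺ : ∀ n {xs ys} → xs ≺ ys → take n xs ≼ take n ys
  ≺-take⁺ zero p = inj₁ refl
  ≺-take⁺ (suc n) (≺-head p) = inj₂ (≺-head p)
  ≺-take⁺ (suc n) (≺-tail p) = ∷-≼ (≺-take⁺ n p)

  ≼-take⁺ : ∀ n {xs ys} → xs ≼ ys → take n xs ≼ take n ys
  ≼-take⁺ n (inj₁ refl) = inj₁ refl
  ≼-take⁺ n (inj₂ p) = ≺-take⁺ n p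

  ≺-compare : ∀ xs ys → length xs ≡ length ys → xs ≺ ys ⊎ xs ≡ ys ⊎ ys ≺ xs
  ≺-compare [] [] e = inj₂ (inj₁ refl)
  ≺-compare (x ∷ xs) (y ∷ ys) e with compare x y
  ... | tri< p _ _ = inj₁ (≺-head p)
  ... | tri> _ _ p = inj₂ (inj₂ (≺-head p))
  ... | tri≈ _ refl _ with ≺-compare xs ys (suc-injective e)
  ...   | inj₁ q = inj₁ (≺-tail q)
  ...   | inj₂ (inj₁ refl) = inj₂ (inj₁ refl)
  ...   | inj₂ (inj₂ q) = inj₂ (inj₂ (≺-tail q))

  ≺⇒Lex : ∀ {xs ys} → xs ≺ ys → Lex-< _≡_ _⊏_ xs ys
  ≺⇒Lex (≺-head p) = this p
  ≺⇒Lex (≺-tail p) = next refl (≺⇒Lex p)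

  -- Merge u v t: t is one interleaving of u and v, i.e. one term of u ш v.
  data Merge : Word → Word → Word → Set a where
    done : Merge [] [] []
    left : ∀ {x u v t} → Merge u v t → Merge (x ∷ u) v (x ∷ t)
    right : ∀ {x u v t} → Merge u v t → Merge u (x ∷ v) (x ∷ t)

  merge-sym : ∀ {u v t} → Merge u v t → Merge v u t
  merge-sym done = done
  merge-sym (left m) = right (merge-sym m)
  merge-sym (right m) = left (merge-sym m)

  merge-length : ∀ {u v t} → Merge u v t → length t ≡ length u + length v
  merge-length done = refl
  merge-length (left m) = cong suc (merge-length m)
  merge-length {u} {x ∷ v} (right m) = trans (cong suc (merge-length m)) (sym (+-suc (length u) (length v)))

  merge-[]ˡ : ∀ {v t} → Merge [] v t → t ≡ v
  merge-[]ˡ done = refl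
  merge-[]ˡ (right m) = cong (_ ∷_) (merge-[]ˡ m)

  merge-[]ʳ : ∀ {u t} → Merge u [] t → t ≡ u
  merge-[]ʳ m = merge-[]ˡ (merge-sym m)

  merge-right : ∀ v → Merge [] v v
  merge-right [] = done
  merge-right (x ∷ v) = right (merge-right v)

  merge-++ : ∀ u v → Merge u v (u ++ v)
  merge-++ [] v = merge-right v
  merge-++ (x ∷ u) v = left (merge-++ u v)

  record PrefixMerge (u v t : Word) (n : ℕ) : Set a where
    constructor prefixMerge
    field
      e f : ℕ
      sum : e + f ≡ n
      e≤ : e ≤ length u
      f≤ : f ≤ length v
      mg : Merge (take e u) (take f v) (take n t)

  merge-prefix : ∀ {u v t} → Merge u v t → ∀ n → n ≤ length t → PrefixMerge u v t n
  merge-prefix m zero _ = prefixMerge 0 0 refl z≤n z≤n done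
  merge-prefix (left m) (suc n) (s≤s le) with merge-prefix m n le
  ... | prefixMerge e f sum e≤ f≤ mg = prefixMerge (suc e) f (cong suc sum) (s≤s e≤) f≤ (left mg)
  merge-prefix (right m) (suc n) (s≤s le) with merge-prefix m n le
  ... | prefixMerge e f sum e≤ f≤ mg =
    prefixMerge e (suc f) (trans (+-suc e f) (cong suc sum)) e≤ (s≤s f≤) (right mg)

  -- Raising the second word raises some interleaving: the one that keeps the same
  -- choices up to the first difference and then appends the rest of v' at once.
  merge-≼ : ∀ {u v v' t} → Merge u v t → v ≼ v' → Σ[ t' ∈ Word ] (Merge u v' t' × t ≼ t')
  merge-≼ {t = t} m (inj₁ refl) = t , m , inj₁ refl
  merge-≼ (left m) (inj₂ p) with merge-≼ m (inj₂ p)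
  ... | t' , m' , q = _ , left m' , ∷-≼ q
  merge-≼ {u = u} (right m) (inj₂ (≺-head {ys = ys} p)) = _ , right (merge-++ u ys) , inj₂ (≺-head p)
  merge-≼ (right m) (inj₂ (≺-tail p)) with merge-≼ m (inj₂ p)
  ... | t' , m' , q = _ , right m' , ∷-≼ q

  merge-All : ∀ {L : List X} {u v t} → Merge u v t → All (_∈ L) u → All (_∈ L) v → All (_∈ L) t
  merge-All done _ _ = []
  merge-All (left m) (p ∷ ps) qs = p ∷ merge-All m ps qs
  merge-All (right m) ps (q ∷ qs) = q ∷ merge-All m ps qs

  All-shuffle⁺ : ∀ {p} {P : Word → Set p} u v → (∀ t → Merge u v t → P t) → All P (shuffle u v)
  All-shuffle⁺ [] v h = h v (merge-right v) ∷ []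
  All-shuffle⁺ (x ∷ u) [] h = h (x ∷ u) (merge-sym (merge-right (x ∷ u))) ∷ []
  All-shuffle⁺ (x ∷ u) (y ∷ v) h =
    All.++⁺ (All.map⁺ (All-shuffle⁺ u (y ∷ v) (λ t m → h (x ∷ t) (left m))))
            (All.map⁺ (All-shuffle⁺ (x ∷ u) v (λ t m → h (y ∷ t) (right m))))

  -- Decides equality exactly as Sh.coeff does, so that coeff (ones ts) w = count w ts.
  count : Word → List Word → ℕ
  count w [] = 0
  count w (t ∷ ts) with ≡-dec _≟_ t w
  ... | yes _ = suc (count w ts)
  ... | no _ = count w ts

  count-++ : ∀ w xs ys → count w (xs ++ ys) ≡ count w xs + count w ys
  count-++ w [] ys = refl
  count-++ w (t ∷ xs) ys with ≡-dec _≟_ t w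
  ... | yes _ = cong suc (count-++ w xs ys)
  ... | no _ = count-++ w xs ys

  count-map-++ : ∀ P w S → count (P ++ w) (map (P ++_) S) ≡ count w S
  count-map-++ P w [] = refl
  count-map-++ P w (t ∷ S) with ≡-dec _≟_ (P ++ t) (P ++ w) | ≡-dec _≟_ t w
  ... | yes _ | yes _ = cong suc (count-map-++ P w S)
  ... | yes e | no ne = ⊥-elim (ne (++-cancelˡ P t w e))
  ... | no ne | yes refl = ⊥-elim (ne refl)
  ... | no _ | no _ = count-map-++ P w S

  count-≺ : ∀ w S → All (_≺ w) S → count w S ≡ 0
  count-≺ w [] _ = refl
  count-≺ w (t ∷ S) (h ∷ hs) with ≡-dec _≟_ t w
  ... | yes refl = ⊥-elim (≺-irrefl h)
  ... | no _ = count-≺ w S hs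

  count-self : ∀ w → count w (w ∷ []) ≡ 1
  count-self w with ≡-dec _≟_ w w
  ... | yes _ = refl
  ... | no ne = ⊥-elim (ne refl)

  shuffle-right : Word → Word → List Word
  shuffle-right u [] = []
  shuffle-right u (y ∷ v) = map (y ∷_) (shuffle u v)

  shuffle-[]ʳ : ∀ u → shuffle u [] ≡ u ∷ []
  shuffle-[]ʳ [] = refl
  shuffle-[]ʳ (x ∷ u) = refl

  shuffle-∷ˡ : ∀ x u v → shuffle (x ∷ u) v ≡ map (x ∷_) (shuffle u v) ++ shuffle-right (x ∷ u) v
  shuffle-∷ˡ x u [] = cong (λ z → map (x ∷_) z ++ []) (sym (shuffle-[]ʳ u))
  shuffle-∷ˡ x u (y ∷ v) = refl

module Periodic {a ℓ : Level} {X : Set a} {_⊏_ : Rel X ℓ}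
                (sto : IsStrictTotalOrder _≡_ _⊏_) where

  open import Defs
  open import Data.Nat using (ℕ; zero; suc; _+_; _∸_; _%_; _≤_; _<_; z≤n; s≤s)
  open import Data.Nat.Properties
    using (+-identityʳ; +-suc; +-comm; ≤-refl; <⇒≤; ≤-<-trans; <-≤-trans; m<m+n; m≤n+m; m∸n≤m; m+[n∸m]≡n; +-monoʳ-<; n≢0⇒n>0; <⇒≢)
  open import Data.Nat.DivMod using (%-distribˡ-+; m%n%n≡m%n; m<n⇒m%n≡m; m%n<n; [m+n]%n≡m%n)
  open import Data.Product using (_×_; _,_; Σ-syntax; proj₂)
  open import Data.Sum using (_⊎_)
  open import Data.List using ([]; _∷_; _++_; length; take; drop)
  open import Data.List.Properties using (take++drop≡id; length-drop; take-all)
  open import Data.List.Relation.Binary.Lex.Core using (this; next)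
  open import Data.List.Relation.Binary.Lex.Strict using (Lex-<)
  open import Relation.Nullary using (¬_)

  open ListLemmas
  open Sh sto using (Word; Lyndon)

  Lex-<-divergence : ∀ {xs ys : Word} (z : X) → Lex-< _≡_ _⊏_ xs ys → length ys < length xs →
                     Σ[ d ∈ ℕ ] (d < length ys × take d xs ≡ take d ys × at xs d z ⊏ at ys d z)
  Lex-<-divergence z (this p) _ = 0 , s≤s z≤n , refl , p
  Lex-<-divergence z (next refl r) (s≤s h) with Lex-<-divergence z r h
  ... | d , d< , agree , less = suc d , s≤s d< , cong (_ ∷_) agree , less

  StartsBelow : X → Word → Set (a ⊔ ℓ)
  StartsBelow y R = R ≡ [] ⊎ Σ[ c ∈ X ] Σ[ R' ∈ Word ] (R ≡ c ∷ R' × c ⊏ y)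

  -- p^ω is the infinite periodic word p p p ⋯ and window k l its factor of length l at position k.
  module Period (x₀ : X) (p₁ : Word) where

    p : Word
    p = x₀ ∷ p₁

    m : ℕ
    m = suc (length p₁)

    p^ω : ℕ → X
    p^ω n = at p (n % m) x₀

    window : ℕ → ℕ → Word
    window k zero = []
    window k (suc l) = p^ω k ∷ window (suc k) l

    window-length : ∀ k l → length (window k l) ≡ l
    window-length k zero = refl
    window-length k (suc l) = cong suc (window-length (suc k) l)

    window-++ : ∀ k a b → window k (a + b) ≡ window k a ++ window (k + a) b
    window-++ k zero b = cong (λ z → window z b) (sym (+-identityʳ k))
    window-++ k (suc a) b =
      cong (p^ω k ∷_) (trans (window-++ (suc k) a b) (cong (λ z → window (suc k) a ++ window z b) (sym (+-suc k a))))

    window-split : ∀ k j r → window k (j + suc r) ≡ window k j ++ p^ω (k + j) ∷ window (suc (k + j)) r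
    window-split k j r = window-++ k j (suc r)

    take-window : ∀ k {e l} → e ≤ l → take e (window k l) ≡ window k e
    take-window k {zero} _ = refl
    take-window k {suc e} {suc l} (s≤s le) = cong (p^ω k ∷_) (take-window (suc k) le)

    drop-window : ∀ k e l → drop e (window k (e + l)) ≡ window (k + e) l
    drop-window k e l = begin
      drop e (window k (e + l))                 ≡⟨ cong (drop e) (window-++ k e l) ⟩
      drop e (window k e ++ window (k + e) l)   ≡⟨ drop-++-length (window k e) (window (k + e) l) (window-length k e) ⟩
      window (k + e) l                          ∎
      where open ≡-Reasoning

    take-window-++ : ∀ k n (R : Word) l → l ≤ n → take l (window k n ++ R) ≡ window k l
    take-window-++ k n R l le = trans (take-++ˡ (window k n) R (subst (l ≤_) (sym (window-length k n)) le)) (take-window k le)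

    drop-window-++ : ∀ k n (R : Word) i → i ≤ n → drop i (window k n ++ R) ≡ window (k + i) (n ∸ i) ++ R
    drop-window-++ k n R i le = begin
      drop i (window k n ++ R)                ≡⟨ drop-++ˡ (window k n) R (subst (i ≤_) (sym (window-length k n)) le) ⟩
      drop i (window k n) ++ R                ≡⟨ cong (λ z → drop i (window k z) ++ R) (sym (m+[n∸m]≡n le)) ⟩
      drop i (window k (i + (n ∸ i))) ++ R    ≡⟨ cong (_++ R) (drop-window k i (n ∸ i)) ⟩
      window (k + i) (n ∸ i) ++ R             ∎
      where open ≡-Reasoning

    window-cong : ∀ {k k'} l → (∀ i → p^ω (k + i) ≡ p^ω (k' + i)) → window k l ≡ window k' l
    window-cong zero h = refl
    window-cong {k} {k'} (suc l) h =
      cong₂ _∷_ (trans (cong p^ω (sym (+-identityʳ k))) (trans (h 0) (cong p^ω (+-identityʳ k'))))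
                (window-cong l (λ i → trans (cong p^ω (sym (+-suc k i))) (trans (h (suc i)) (cong p^ω (+-suc k' i)))))

    %-shift : ∀ k i → (k + i) % m ≡ (k % m + i) % m
    %-shift k i = begin
      (k + i) % m                    ≡⟨ %-distribˡ-+ k i m ⟩
      (k % m + i % m) % m            ≡⟨ cong (λ z → (z + i % m) % m) (sym (m%n%n≡m%n k m)) ⟩
      (k % m % m + i % m) % m        ≡⟨ sym (%-distribˡ-+ (k % m) i m) ⟩
      (k % m + i) % m                ∎
      where open ≡-Reasoning

    p^ω-mod : ∀ k k' → k % m ≡ k' % m → ∀ i → p^ω (k + i) ≡ p^ω (k' + i)
    p^ω-mod k k' e i =
      cong (λ z → at p z x₀) (trans (%-shift k i) (trans (cong (λ z → (z + i) % m) e) (sym (%-shift k' i))))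

    window-mod : ∀ k k' l → k % m ≡ k' % m → window k l ≡ window k' l
    window-mod k k' l e = window-cong l (p^ω-mod k k' e)

    p^ω-<m : ∀ n → n < m → p^ω n ≡ at p n x₀
    p^ω-<m n h = cong (λ z → at p z x₀) (m<n⇒m%n≡m h)

    window-inside : ∀ f l → f + l ≤ m → window f l ≡ take l (drop f p)
    window-inside f zero _ = refl
    window-inside f (suc l) le =
      trans (cong₂ _∷_ (p^ω-<m f f<m) (window-inside (suc f) l (subst (_≤ m) (+-suc f l) le)))
            (sym (cong (take (suc l)) (drop-at p f x₀ f<m)))
      where f<m : f < m
            f<m = <-≤-trans (m<m+n f (s≤s z≤n)) le

    window-prefix : ∀ l → l ≤ m → window 0 l ≡ take l p
    window-prefix l le = window-inside 0 l le

    window-period : window 0 m ≡ p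
    window-period = trans (window-prefix m ≤-refl) (take-all m p ≤-refl)

    window-shift : ∀ k l → window (m + k) l ≡ window k l
    window-shift k l = window-mod (m + k) k l (trans (cong (_% m) (+-comm m k)) ([m+n]%n≡m%n k m))

    p++window : ∀ l → p ++ window 0 l ≡ window 0 (m + l)
    p++window l = sym (trans (window-++ 0 m l)
      (cong₂ _++_ window-period (trans (cong (λ z → window z l) (sym (+-identityʳ m))) (window-shift 0 l))))

    module LyndonPeriod (lyn : Lyndon p) where

      suffix-divergence : ∀ f → 0 < f → f < m →
        Σ[ d ∈ ℕ ] (f + d < m × take d p ≡ take d (drop f p) × at p d x₀ ⊏ at p (f + d) x₀)
      suffix-divergence f@(suc f') _ f<m with Lex-<-divergence x₀ p<suffix suffix-shorter
        where
        p<suffix : Lex-< _≡_ _⊏_ p (drop f p)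
        p<suffix = proj₂ lyn (take f p) (drop f p) (sym (take++drop≡id f p))
                     (x₀ , take f' p₁ , refl) (at p f x₀ , drop (suc f) p , drop-at p f x₀ f<m)
        suffix-shorter : length (drop f p) < m
        suffix-shorter = s≤s (subst (_≤ length p₁) (sym (length-drop f' p₁)) (m∸n≤m (length p₁) f'))
      ... | d , d<suffix , agree , less = d , f+d<m , agree , subst (at p d x₀ ⊏_) (at-drop p f d x₀) less
        where
        f+d<m : f + d < m
        f+d<m = subst (f + d <_) (m+[n∸m]≡n (<⇒≤ f<m)) (+-monoʳ-< f (subst (d <_) (length-drop f p) d<suffix))

      -- A Lyndon word is strictly smaller than its proper rotations.
      shift-divergence : ∀ k → ¬ (k % m ≡ 0) →
        Σ[ d ∈ ℕ ] (k % m + d < m × window k d ≡ window 0 d × p^ω d ⊏ p^ω (k + d))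
      shift-divergence k nz with suffix-divergence (k % m) (n≢0⇒n>0 nz) (m%n<n k m)
      ... | d , fd<m , agree , less = d , fd<m , windows-agree , p^ω-less
        where
        f : ℕ
        f = k % m
        d<m : d < m
        d<m = ≤-<-trans (m≤n+m d f) fd<m
        k≡f : k % m ≡ f % m
        k≡f = sym (m%n%n≡m%n k m)
        windows-agree : window k d ≡ window 0 d
        windows-agree = begin
          window k d         ≡⟨ window-mod k f d k≡f ⟩
          window f d         ≡⟨ window-inside f d (<⇒≤ fd<m) ⟩
          take d (drop f p)  ≡⟨ sym agree ⟩
          take d p           ≡⟨ sym (window-prefix d (<⇒≤ d<m)) ⟩
          window 0 d         ∎
          where open ≡-Reasoning
        p^ω-less : p^ω d ⊏ p^ω (k + d)
        p^ω-less = subst₂ _⊏_ (sym (p^ω-<m d d<m)) (trans (sym (p^ω-<m (f + d) fd<m)) (sym (p^ω-mod k f k≡f d))) less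

      inner-divergence : ∀ j → 0 < j → j < m →
        Σ[ d ∈ ℕ ] (j + d < m × window j d ≡ window 0 d × p^ω d ⊏ p^ω (j + d))
      inner-divergence j 0<j j<m with shift-divergence j (λ e → <⇒≢ 0<j (sym (trans (sym j%m≡j) e)))
        where
        j%m≡j : j % m ≡ j
        j%m≡j = m<n⇒m%n≡m j<m
      ... | d , jd<m , wk , pd = d , subst (λ z → z + d < m) (m<n⇒m%n≡m j<m) jd<m , wk , pd

module WindowMerges {a ℓ : Level} {X : Set a} {_⊏_ : Rel X ℓ}
                    (sto : IsStrictTotalOrder _≡_ _⊏_) where

  open import Defs
  open import Data.Nat using (ℕ; zero; suc; _+_; _%_; _≤_; _<_; _≟_; _<?_)
  open import Data.Nat.Properties
    using (+-identityʳ; +-suc; +-comm; ≤-pred; <-trans; ≤-<-trans; n<1+n; m≤m+n; ≮⇒≥; m≤n⇒∃[o]m+o≡n)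
  open import Data.Product using (_×_; _,_; Σ-syntax)
  open import Data.Sum using (_⊎_; inj₁; inj₂)
  open import Data.List using (_∷_; _++_; length; take)
  open import Relation.Nullary using (yes; no)

  open WordOrder sto
  open Periodic sto
  open Sh sto using (Word; Lyndon)

  module LyndonWindows (x₀ : X) (p₁ : Word) (lyn : Lyndon (x₀ ∷ p₁)) where
    open Period x₀ p₁
    open LyndonPeriod lyn

    Divergence : ℕ → ℕ → Set _
    Divergence k l = Σ[ d ∈ ℕ ] (d < l × window k d ≡ window 0 d × p^ω d ⊏ p^ω (k + d))

    window-≺ : ∀ k d l → window k d ≡ window 0 d → p^ω d ⊏ p^ω (k + d) → d < l → window 0 l ≺ window k l
    window-≺ k d l wk pd d<l with m≤n⇒∃[o]m+o≡n d<l
    ... | r , refl = subst₂ _≺_ (sym (split 0)) (sym (split k))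
                       (subst (λ z → z ++ p^ω d ∷ window (suc d) r ≺ window k d ++ p^ω (k + d) ∷ window (suc (k + d)) r) wk
                              (++-≺ (window k d) (≺-head pd)))
      where
      split : ∀ j → window j (suc d + r) ≡ window j d ++ p^ω (j + d) ∷ window (suc (j + d)) r
      split j = trans (cong (window j) (sym (+-suc d r))) (window-split j d r)

    window-agree : ∀ k d l → window k d ≡ window 0 d → l ≤ d → window k l ≡ window 0 l
    window-agree k d l wk le = trans (sym (take-window k le)) (trans (cong (take l) wk) (take-window 0 le))

    window-compare : ∀ k l → window k l ≡ window 0 l ⊎ Divergence k l
    window-compare k l with k % m ≟ 0
    ... | yes z = inj₁ (window-mod k 0 l z)
    ... | no nz with shift-divergence k nz
    ...   | d , _ , wk , pd with d <? l
    ...     | yes d<l = inj₂ (d , d<l , wk , pd)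
    ...     | no d≮l = inj₁ (window-agree k d l wk (≮⇒≥ d≮l))

    window-0-≼ : ∀ k l → window 0 l ≼ window k l
    window-0-≼ k l with window-compare k l
    ... | inj₁ e = inj₁ (sym e)
    ... | inj₂ (d , d<l , wk , pd) = inj₂ (window-≺ k d l wk pd d<l)

    ≺-at-divergence : ∀ {u t} k d → window k d ≡ window 0 d → p^ω d ⊏ p^ω (k + d) →
                      take (suc d) u ≼ window 0 (suc d) → take (suc d) t ≡ window k (suc d) → u ≺ t
    ≺-at-divergence k d wk pd u≼ t≡ =
      ≺-take⁻ (suc d) (≼-≺-trans u≼ (subst (window 0 (suc d) ≺_) (sym t≡) (window-≺ k d (suc d) wk pd (n<1+n d))))

    MergeBound : ℕ → Set _
    MergeBound N = ∀ a b t → a + b < N → Merge (window 0 a) (window 0 b) t → t ≼ window 0 (a + b)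

    aligned-merge-≼ : ∀ N → MergeBound N → ∀ k a b u → a + b < N → window k (a + b) ≡ window 0 (a + b) →
                      Merge (window k a) (window 0 b) u → u ≼ window k (a + b)
    aligned-merge-≼ N ih k a b u bd aligned mg =
      subst (u ≼_) (sym aligned) (ih a b u bd (subst (λ w → Merge w (window 0 b) u) window-a mg))
      where
      window-a : window k a ≡ window 0 a
      window-a = window-agree k (a + b) a aligned (m≤m+n a b)

    divergent-merge-≺ : ∀ N → MergeBound N → ∀ k a b u → suc a + suc b < N → Divergence k (suc a + suc b) →
                        Merge (window k (suc a)) (window 1 b) u → (p^ω 0 ∷ u) ≺ window k (suc a + suc b)
    divergent-merge-≺ N ih k a b u bd (d , d<n , wk , pd) mg with merge-prefix mg d d≤u
      where
      d≤u : d ≤ length u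
      d≤u = subst (d ≤_) (sym (trans (merge-length mg) (cong₂ _+_ (window-length k (suc a)) (window-length 1 b))))
                  (≤-pred (subst (d <_) (+-suc (suc a) b) d<n))
    ... | prefixMerge e f sum e≤ f≤ mg′ =
      ≺-at-divergence k d wk pd (subst (λ z → take (suc d) (p^ω 0 ∷ u) ≼ window 0 z) e+1+f≡1+d (ih e (suc f) _ bound prefix-merge))
                                (take-window k d<n)
      where
      e+1+f≡1+d : e + suc f ≡ suc d
      e+1+f≡1+d = trans (+-suc e f) (cong suc sum)
      bound : e + suc f < N
      bound = subst (_< N) (sym e+1+f≡1+d) (≤-<-trans d<n bd)
      prefix-merge : Merge (window 0 e) (window 0 (suc f)) (take (suc d) (p^ω 0 ∷ u))
      prefix-merge = subst₂ (λ A B → Merge A B (take (suc d) (p^ω 0 ∷ u)))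
        (trans (take-window k (subst (e ≤_) (window-length k (suc a)) e≤))
               (window-agree k d e wk (subst (e ≤_) sum (m≤m+n e f))))
        (cong (p^ω 0 ∷_) (take-window 1 (subst (f ≤_) (window-length 1 b) f≤)))
        (right mg′)

    shifted-merge-≼ : ∀ N → MergeBound N → ∀ k a b u → a + b < N →
                      Merge (window k a) (window 0 b) u → u ≼ window k (a + b)
    shifted-merge-≼ N ih k zero b u bd mg rewrite merge-[]ˡ mg = window-0-≼ k b
    shifted-merge-≼ N ih k (suc a) zero u bd mg rewrite merge-[]ʳ mg | +-identityʳ a = inj₁ refl
    shifted-merge-≼ N ih k (suc a) (suc b) (_ ∷ u) bd (left mg) =
      ∷-≼ (shifted-merge-≼ N ih (suc k) a (suc b) u (<-trans (n<1+n _) bd) mg)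
    shifted-merge-≼ N ih k (suc a) (suc b) (_ ∷ u) bd (right mg) with window-compare k (suc a + suc b)
    ... | inj₁ aligned = aligned-merge-≼ N ih k (suc a) (suc b) _ bd aligned (right mg)
    ... | inj₂ div = inj₂ (divergent-merge-≺ N ih k a b u bd div mg)

    merge-bound : ∀ N → MergeBound N
    merge-bound (suc N) zero b t bd mg rewrite merge-[]ˡ mg = inj₁ refl
    merge-bound (suc N) (suc a) zero t bd mg rewrite merge-[]ʳ mg | +-identityʳ a = inj₁ refl
    merge-bound (suc N) (suc a) (suc b) (_ ∷ t) bd (left mg) =
      ∷-≼ (shifted-merge-≼ N (merge-bound N) 1 a (suc b) t (≤-pred bd) mg)
    merge-bound (suc N) (suc a) (suc b) (_ ∷ t) bd (right mg) =
      ∷-≼ (subst (λ z → t ≼ window 1 z) swap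
             (shifted-merge-≼ N (merge-bound N) 1 b (suc a) t (subst (_< N) (sym swap) (≤-pred bd)) (merge-sym mg)))
      where
      swap : b + suc a ≡ a + suc b
      swap = trans (+-comm b (suc a)) (sym (+-suc a b))

    window-merge-≼ : ∀ a b t → Merge (window 0 a) (window 0 b) t → t ≼ window 0 (a + b)
    window-merge-≼ a b t mg = merge-bound (suc (a + b)) a b t (n<1+n _) mg

    merge-below-window-≼ : ∀ e v t → v ≼ window 0 (length v) → Merge (window 0 e) v t → t ≼ window 0 (e + length v)
    merge-below-window-≼ e v t le mg with merge-≼ mg le
    ... | t' , mg' , q = ≼-trans q (window-merge-≼ e (length v) t' mg')

module Maximality {a ℓ : Level} {X : Set a} {_⊏_ : Rel X ℓ}
                  (sto : IsStrictTotalOrder _≡_ _⊏_) where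

  open import Defs
  open import Data.Nat using (ℕ; zero; suc; _+_; _∸_; _%_; _≤_; _<_; _≤?_; _≟_; z≤n; s≤s)
  open import Data.Nat.Properties
    using (+-identityʳ; +-suc; +-comm; +-∸-assoc; ≤-refl; ≤-trans; ≤-pred; ≤-<-trans; <⇒≤; n≮n; ≰⇒>; <⇒≱;
           m≤m+n; m≤n+m; +-monoʳ-≤; +-mono-≤; m≤n⇒∃[o]m+o≡n; m+[n∸m]≡n; module ≤-Reasoning)
  open import Data.Product using (_×_; _,_; Σ-syntax)
  open import Data.Sum using (_⊎_; inj₁; inj₂)
  open import Data.Empty using (⊥-elim)
  open import Data.List using ([]; _∷_; _++_; map; length; take; drop)
  open import Data.List.Properties using (++-assoc; length-++; take++drop≡id; ++-identityʳ; map-++; map-id)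
  open import Data.List.Relation.Unary.All using (All; []; _∷_)
  import Data.List.Relation.Unary.All.Properties as All
  open import Relation.Nullary using (¬_; yes; no)

  open ListLemmas
  open WordOrder sto
  open Periodic sto
  open WindowMerges sto
  open Sh sto using (Word; Lyndon; shuffle)

  module LyndonFactor (x₀ : X) (p₁ : Word) (lyn : Lyndon (x₀ ∷ p₁)) where
    open Period x₀ p₁
    open LyndonPeriod lyn
    open LyndonWindows x₀ p₁ lyn

    Bounded : Word → Set (a ⊔ ℓ)
    Bounded v = v ≼ window 0 (length v)

    length-window-++ : ∀ k l R → length (window k l ++ R) ≡ l + length R
    length-window-++ k l R = trans (length-++ (window k l)) (cong (_+ length R) (window-length k l))

    window++-≼ : ∀ k l R → StartsBelow (p^ω (k + l)) R → (window k l ++ R) ≼ window k (length (window k l ++ R))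
    window++-≼ k l R below = subst (λ z → (window k l ++ R) ≼ window k z) (sym (length-window-++ k l R)) (bound below)
      where
      bound : StartsBelow (p^ω (k + l)) R → (window k l ++ R) ≼ window k (l + length R)
      bound (inj₁ refl) = inj₁ (trans (++-identityʳ (window k l)) (cong (window k) (sym (+-identityʳ l))))
      bound (inj₂ (c , R' , refl , c⊏)) =
        inj₂ (subst ((window k l ++ c ∷ R') ≺_) (sym (window-++ k l (suc (length R')))) (++-≺ (window k l) (≺-head c⊏)))

    take-≼-window : ∀ k xs f → xs ≼ window k (length xs) → f ≤ length xs → take f xs ≼ window k f
    take-≼-window k xs f h le = subst (take f xs ≼_) (take-window k le) (≼-take⁺ f h)

    bounded-take : ∀ v f → Bounded v → f ≤ length v → Bounded (take f v)
    bounded-take v f h le = subst (λ z → take f v ≼ window 0 z) (sym (length-take-≤ f v le)) (take-≼-window 0 v f h le)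

    suffix-merge-≺ : ∀ j → 0 < j → j < m → ∀ y V u → Bounded (y ∷ V) → Merge (drop j p) V u →
                     (y ∷ u) ≺ drop j p ++ y ∷ V
    suffix-merge-≺ j 0<j j<m y V u bounded mg with inner-divergence j 0<j j<m
    ... | d , j+d<m , wk , pd = ≺-at-divergence j d wk pd prefix≼ prefix≡
      where
      d<suffix : d < length (drop j p)
      d<suffix = <-length-drop j d p j+d<m
      prefix≡ : take (suc d) (drop j p ++ y ∷ V) ≡ window j (suc d)
      prefix≡ = trans (take-++ˡ (drop j p) (y ∷ V) d<suffix)
                      (sym (window-inside j (suc d) (subst (_≤ m) (sym (+-suc j d)) j+d<m)))
      d≤u : d ≤ length u
      d≤u = ≤-trans (<⇒≤ d<suffix) (subst (length (drop j p) ≤_) (sym (merge-length mg)) (m≤m+n _ _))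
      prefix≼ : take (suc d) (y ∷ u) ≼ window 0 (suc d)
      prefix≼ with merge-prefix mg d d≤u
      ... | prefixMerge e f sum e≤ f≤ mg′ =
        subst (λ z → take (suc d) (y ∷ u) ≼ window 0 z)
              (trans (cong (e +_) (length-take-≤ (suc f) (y ∷ V) (s≤s f≤))) (trans (+-suc e f) (cong suc sum)))
              (merge-below-window-≼ e (take (suc f) (y ∷ V)) _ (bounded-take (y ∷ V) (suc f) bounded (s≤s f≤))
                 (subst (λ A → Merge A (take (suc f) (y ∷ V)) (take (suc d) (y ∷ u))) window-e (right mg′)))
        where
        e≤d : e ≤ d
        e≤d = subst (e ≤_) sum (m≤m+n e f)
        window-e : take e (drop j p) ≡ window 0 e
        window-e = trans (sym (window-inside j e (≤-trans (+-monoʳ-≤ j e≤d) (<⇒≤ j+d<m)))) (window-agree j d e wk e≤d)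

    suffix-right-≺ : ∀ j x q → x ∷ q ≡ drop j p → 0 < j → ∀ y V u → Bounded (y ∷ V) →
                     Merge (x ∷ q) V u → (y ∷ u) ≺ (x ∷ q) ++ y ∷ V
    suffix-right-≺ j x q q≡ 0<j y V u bounded mg =
      subst (λ z → (y ∷ u) ≺ z ++ y ∷ V) (sym q≡)
            (suffix-merge-≺ j 0<j (drop-≡-∷⇒< j p (sym q≡)) y V u bounded (subst (λ z → Merge z V u) q≡ mg))

    suffix-merge-≼ : ∀ j q → q ≡ drop j p → 0 < j → ∀ V → Bounded V → ∀ u → Merge q V u → u ≼ q ++ V
    suffix-merge-≼ j [] _ _ V _ u mg = inj₁ (merge-[]ˡ mg)
    suffix-merge-≼ j (x ∷ q) q≡ 0<j V bounded (.x ∷ u) (left mg) =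
      ∷-≼ (suffix-merge-≼ (suc j) q (sym (drop-≡-∷⇒drop-suc j p (sym q≡))) (s≤s z≤n) V bounded u mg)
    suffix-merge-≼ j (x ∷ q) q≡ 0<j (y ∷ V) bounded (.y ∷ u) (right mg) =
      inj₂ (suffix-right-≺ j x q q≡ 0<j y V u bounded mg)

    shuffle-right-≺ : ∀ j x q → x ∷ q ≡ drop j p → 0 < j → ∀ V → Bounded V →
                      All (_≺ (x ∷ q) ++ V) (shuffle-right (x ∷ q) V)
    shuffle-right-≺ j x q q≡ 0<j [] _ = []
    shuffle-right-≺ j x q q≡ 0<j (y ∷ V) bounded =
      All.map⁺ (All-shuffle⁺ (x ∷ q) V (λ u mg → suffix-right-≺ j x q q≡ 0<j y V u bounded mg))

    suffix-count : ∀ j q → q ≡ drop j p → 0 < j → ∀ V → Bounded V → count (q ++ V) (shuffle q V) ≡ 1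
    suffix-count j [] _ _ V _ = count-self V
    suffix-count j (x ∷ q) q≡ 0<j V bounded = begin
      count (x ∷ q ++ V) (shuffle (x ∷ q) V)
        ≡⟨ cong (count _) (shuffle-∷ˡ x q V) ⟩
      count (x ∷ q ++ V) (map (x ∷_) (shuffle q V) ++ shuffle-right (x ∷ q) V)
        ≡⟨ count-++ _ (map (x ∷_) (shuffle q V)) _ ⟩
      count (x ∷ q ++ V) (map (x ∷_) (shuffle q V)) + count (x ∷ q ++ V) (shuffle-right (x ∷ q) V)
        ≡⟨ cong₂ _+_ (count-map-++ (x ∷ []) (q ++ V) (shuffle q V)) (count-≺ _ _ (shuffle-right-≺ j x q q≡ 0<j V bounded)) ⟩
      count (q ++ V) (shuffle q V) + 0
        ≡⟨ cong (_+ 0) (suffix-count (suc j) q (sym (drop-≡-∷⇒drop-suc j p (sym q≡))) (s≤s z≤n) V bounded) ⟩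
      1 ∎
      where open ≡-Reasoning

    -- The shape w = p V of a non-Lyndon word produced by DuvalFactorisation.factorise.
    module Factored (L : ℕ) (R : Word) (R-below : StartsBelow (p^ω L) R) where

      V : Word
      V = window 0 L ++ R

      w : Word
      w = p ++ V

      V-bounded : Bounded V
      V-bounded = window++-≼ 0 L R R-below

      w≡window++R : w ≡ window 0 (m + L) ++ R
      w≡window++R = trans (sym (++-assoc p (window 0 L) R)) (cong (_++ R) (p++window L))

      module Position (i : ℕ) (i≤L : i ≤ L) where

        i≤m+L : i ≤ m + L
        i≤m+L = ≤-trans i≤L (m≤n+m L m)

        take-V : take i V ≡ window 0 i
        take-V = take-window-++ 0 L R i i≤L

        drop-V : drop i V ≡ window i (L ∸ i) ++ R
        drop-V = drop-window-++ 0 L R i i≤L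

        drop-w : drop i w ≡ window i (m + L ∸ i) ++ R
        drop-w = trans (cong (drop i) w≡window++R) (drop-window-++ 0 (m + L) R i i≤m+L)

        w≡window++drop : w ≡ window 0 i ++ drop i w
        w≡window++drop = trans (sym (take++drop≡id i w))
          (cong (_++ drop i w) (trans (cong (take i) w≡window++R) (take-window-++ 0 (m + L) R i i≤m+L)))

        R-below-i : StartsBelow (p^ω (i + (L ∸ i))) R
        R-below-i = subst (λ z → StartsBelow (p^ω z) R) (sym (m+[n∸m]≡n i≤L)) R-below

        drop-V-≼ : drop i V ≼ window i (length (drop i V))
        drop-V-≼ = subst (λ A → A ≼ window i (length A)) (sym drop-V) (window++-≼ i (L ∸ i) R R-below-i)

      Reinsertion : ℕ → Set (a ⊔ ℓ)
      Reinsertion i = (∀ u → Merge p₁ (drop i V) u → take i V ++ x₀ ∷ u ≺ w)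
                    ⊎ Σ[ V' ∈ Word ] (drop i V ≡ V' × Bounded V' × take i V ++ p ++ V' ≡ w)

      reinsert-beyond-≺ : ∀ i → L < i → i ≤ length V → StartsBelow (p^ω L) R → ∀ u → take i V ++ x₀ ∷ u ≺ w
      reinsert-beyond-≺ i L<i i≤V (inj₁ refl) u =
        ⊥-elim (<⇒≱ L<i (subst (i ≤_) (trans (length-window-++ 0 L []) (+-identityʳ L)) i≤V))
      reinsert-beyond-≺ i L<i i≤V (inj₂ (c , R' , refl , c⊏)) u with m≤n⇒∃[o]m+o≡n (<⇒≤ L<i)
      ... | zero , refl = ⊥-elim (n≮n L (subst (L <_) (+-identityʳ L) L<i))
      ... | suc o , refl = subst₂ _≺_ (sym lhs) (sym rhs) (++-≺ (window 0 L) (≺-head c⊏))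
        where
        lhs : take (L + suc o) V ++ x₀ ∷ u ≡ window 0 L ++ c ∷ (take o R' ++ x₀ ∷ u)
        lhs = trans (cong (_++ x₀ ∷ u) (take-++-length (window 0 L) (c ∷ R') (suc o) (window-length 0 L)))
                    (++-assoc (window 0 L) (c ∷ take o R') (x₀ ∷ u))
        rhs : w ≡ window 0 L ++ (window L m ++ c ∷ R')
        rhs = trans w≡window++R (trans (cong (λ z → window 0 z ++ c ∷ R') (+-comm m L))
                (trans (cong (_++ c ∷ R') (window-++ 0 L m)) (++-assoc (window 0 L) (window L m) (c ∷ R'))))

      reinsert-aligned : ∀ i → i ≤ L → i % m ≡ 0 →
                         Σ[ V' ∈ Word ] (drop i V ≡ V' × Bounded V' × take i V ++ p ++ V' ≡ w)
      reinsert-aligned i i≤L i%m≡0 = V' , drop-V≡V' , V'-bounded , reassemble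
        where
        open Position i i≤L
        V' : Word
        V' = window 0 (L ∸ i) ++ R
        drop-V≡V' : drop i V ≡ V'
        drop-V≡V' = trans drop-V (cong (_++ R) (window-mod i 0 (L ∸ i) i%m≡0))
        V'-bounded : Bounded V'
        V'-bounded = window++-≼ 0 (L ∸ i) R (subst (λ y → StartsBelow y R) (p^ω-mod i 0 i%m≡0 (L ∸ i)) R-below-i)
        p++V'≡drop : p ++ V' ≡ drop i w
        p++V'≡drop = begin
          p ++ (window 0 (L ∸ i) ++ R)     ≡⟨ sym (++-assoc p (window 0 (L ∸ i)) R) ⟩
          (p ++ window 0 (L ∸ i)) ++ R     ≡⟨ cong (_++ R) (p++window (L ∸ i)) ⟩
          window 0 (m + (L ∸ i)) ++ R      ≡⟨ cong (λ z → window 0 z ++ R) (sym (+-∸-assoc m i≤L)) ⟩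
          window 0 (m + L ∸ i) ++ R        ≡⟨ cong (_++ R) (window-mod 0 i (m + L ∸ i) (sym i%m≡0)) ⟩
          window i (m + L ∸ i) ++ R        ≡⟨ sym drop-w ⟩
          drop i w                         ∎
          where open ≡-Reasoning
        reassemble : take i V ++ p ++ V' ≡ w
        reassemble = trans (cong₂ _++_ take-V p++V'≡drop) (sym w≡window++drop)

      -- Off the period, the Lyndon property of p forces a drop below w.
      reinsert-divergent-≺ : ∀ i → i ≤ L → ¬ (i % m ≡ 0) → ∀ u → Merge p₁ (drop i V) u → take i V ++ x₀ ∷ u ≺ w
      reinsert-divergent-≺ i i≤L i%m≢0 u mg with shift-divergence i i%m≢0
      ... | d , id<m , wk , pd =
        subst₂ _≺_ (cong (_++ x₀ ∷ u) (sym take-V)) (sym w≡window++drop)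
          (++-≺ (window 0 i) (≺-at-divergence i d wk pd prefix≼ prefix≡))
        where
        open Position i i≤L
        d<m : d < m
        d<m = ≤-<-trans (m≤n+m d (i % m)) id<m
        prefix≡ : take (suc d) (drop i w) ≡ window i (suc d)
        prefix≡ = trans (cong (take (suc d)) drop-w)
          (take-window-++ i (m + L ∸ i) R (suc d) (≤-trans d<m (subst (m ≤_) (sym (+-∸-assoc m i≤L)) (m≤m+n m (L ∸ i)))))
        prefix≼ : take (suc d) (x₀ ∷ u) ≼ window 0 (suc d)
        prefix≼ with merge-prefix mg d (subst (d ≤_) (sym (merge-length mg)) (≤-trans (≤-pred d<m) (m≤m+n _ _)))
        ... | prefixMerge e f sum e≤ f≤ mg′ =
          subst (λ z → take (suc d) (x₀ ∷ u) ≼ window 0 z) (trans (cong (suc e +_) (length-take-≤ f (drop i V) f≤)) (cong suc sum))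
            (merge-below-window-≼ (suc e) (take f (drop i V)) _ bounded
              (subst (λ A → Merge A (take f (drop i V)) (take (suc d) (x₀ ∷ u))) (sym (window-prefix (suc e) (s≤s e≤))) (left mg′)))
          where
          bounded : Bounded (take f (drop i V))
          bounded = subst (take f (drop i V) ≼_)
            (trans (window-agree i d f wk (subst (f ≤_) sum (m≤n+m f e))) (cong (window 0) (sym (length-take-≤ f (drop i V) f≤))))
            (take-≼-window i (drop i V) f drop-V-≼ f≤)

      reinsertion : ∀ i → i ≤ length V → Reinsertion i
      reinsertion i i≤V with i ≤? L
      ... | no i≰L = inj₁ (λ u _ → reinsert-beyond-≺ i (≰⇒> i≰L) i≤V R-below u)
      ... | yes i≤L with i % m ≟ 0
      ...   | yes i%m≡0 = inj₂ (reinsert-aligned i i≤L i%m≡0)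
      ...   | no i%m≢0 = inj₁ (reinsert-divergent-≺ i i≤L i%m≢0)

      reinsert-≼ : ∀ i → i ≤ length V → ∀ u → Merge p₁ (drop i V) u → take i V ++ x₀ ∷ u ≼ w
      reinsert-≼ i i≤V u mg with reinsertion i i≤V
      ... | inj₁ below = inj₂ (below u mg)
      ... | inj₂ (V' , drop≡V' , V'-bounded , reassemble) =
        subst (take i V ++ x₀ ∷ u ≼_) reassemble
          (++-≼ (take i V) (∷-≼ (suffix-merge-≼ 1 p₁ refl (s≤s z≤n) V' V'-bounded u (subst (λ q → Merge p₁ q u) drop≡V' mg))))

      reinsert-count : ∀ i → i ≤ length V → count w (map (take i V ++_) (map (x₀ ∷_) (shuffle p₁ (drop i V)))) ≤ 1
      reinsert-count i i≤V with reinsertion i i≤V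
      ... | inj₁ below = subst (_≤ 1) (sym (count-≺ w _ (All.map⁺ (All.map⁺ (All-shuffle⁺ p₁ (drop i V) below))))) z≤n
      ... | inj₂ (V' , drop≡V' , V'-bounded , reassemble) = subst (_≤ 1) (sym count≡1) ≤-refl
        where
        open ≡-Reasoning
        count≡1 : count w (map (take i V ++_) (map (x₀ ∷_) (shuffle p₁ (drop i V)))) ≡ 1
        count≡1 = begin
          count w (map (take i V ++_) (map (x₀ ∷_) (shuffle p₁ (drop i V))))
            ≡⟨ cong (λ z → count z (map (take i V ++_) (map (x₀ ∷_) (shuffle p₁ (drop i V))))) (sym reassemble) ⟩
          count (take i V ++ p ++ V') (map (take i V ++_) (map (x₀ ∷_) (shuffle p₁ (drop i V))))
            ≡⟨ count-map-++ (take i V) (p ++ V') (map (x₀ ∷_) (shuffle p₁ (drop i V))) ⟩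
          count (x₀ ∷ p₁ ++ V') (map (x₀ ∷_) (shuffle p₁ (drop i V)))
            ≡⟨ count-map-++ (x₀ ∷ []) (p₁ ++ V') (shuffle p₁ (drop i V)) ⟩
          count (p₁ ++ V') (shuffle p₁ (drop i V))
            ≡⟨ cong (λ z → count (p₁ ++ V') (shuffle p₁ z)) drop≡V' ⟩
          count (p₁ ++ V') (shuffle p₁ V')
            ≡⟨ suffix-count 1 p₁ refl (s≤s z≤n) V' V'-bounded ⟩
          1 ∎

      offset-merge-≼ : ∀ i q → q ≡ drop i V → i ≤ length V → ∀ u → Merge p q u → take i V ++ u ≼ w
      offset-merge-≼ i [] q≡ i≤V u mg rewrite merge-[]ʳ mg =
        reinsert-≼ i i≤V p₁ (subst (λ q → Merge p₁ q p₁) q≡ (merge-sym (merge-right p₁)))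
      offset-merge-≼ i (y ∷ q) q≡ i≤V (.x₀ ∷ u) (left mg) = reinsert-≼ i i≤V u (subst (λ q → Merge p₁ q u) q≡ mg)
      offset-merge-≼ i (y ∷ q) q≡ i≤V (.y ∷ u) (right mg) =
        subst (_≼ w) (trans (cong (_++ u) (drop-≡-∷⇒take-suc i V (sym q≡))) (++-assoc (take i V) (y ∷ []) u))
          (offset-merge-≼ (suc i) q (sym (drop-≡-∷⇒drop-suc i V (sym q≡))) (drop-≡-∷⇒< i V (sym q≡)) u mg)

      shuffle-≼ : ∀ u → Merge p V u → u ≼ w
      shuffle-≼ u mg = offset-merge-≼ 0 V refl z≤n u mg

      offset-count : ∀ i q → q ≡ drop i V → i ≤ length V → count w (map (take i V ++_) (shuffle p q)) ≤ suc (length q)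
      right-count : ∀ i q → q ≡ drop i V → count w (map (take i V ++_) (shuffle-right p q)) ≤ length q

      offset-count i q q≡ i≤V = begin
        count w (map (take i V ++_) (shuffle p q))
          ≡⟨ cong (λ z → count w (map (take i V ++_) z)) (shuffle-∷ˡ x₀ p₁ q) ⟩
        count w (map (take i V ++_) (map (x₀ ∷_) (shuffle p₁ q) ++ shuffle-right p q))
          ≡⟨ cong (count w) (map-++ (take i V ++_) (map (x₀ ∷_) (shuffle p₁ q)) (shuffle-right p q)) ⟩
        count w (map (take i V ++_) (map (x₀ ∷_) (shuffle p₁ q)) ++ map (take i V ++_) (shuffle-right p q))
          ≡⟨ count-++ w (map (take i V ++_) (map (x₀ ∷_) (shuffle p₁ q))) (map (take i V ++_) (shuffle-right p q)) ⟩
        count w (map (take i V ++_) (map (x₀ ∷_) (shuffle p₁ q))) + count w (map (take i V ++_) (shuffle-right p q))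
          ≤⟨ +-mono-≤ (subst (λ z → count w (map (take i V ++_) (map (x₀ ∷_) (shuffle p₁ z))) ≤ 1) (sym q≡) (reinsert-count i i≤V))
                      (right-count i q q≡) ⟩
        suc (length q) ∎
        where open ≤-Reasoning

      right-count i [] _ = z≤n
      right-count i (y ∷ q) q≡ =
        subst (_≤ suc (length q))
          (cong (count w) (trans (cong (λ z → map (z ++_) (shuffle p q)) (drop-≡-∷⇒take-suc i V (sym q≡)))
                                 (sym (map-++-∷ (take i V) y (shuffle p q)))))
          (offset-count (suc i) q (sym (drop-≡-∷⇒drop-suc i V (sym q≡))) (drop-≡-∷⇒< i V (sym q≡)))

      count-bounds : 1 ≤ count w (shuffle p V) × count w (shuffle p V) ≤ suc (length V)
      count-bounds = lower , subst (λ z → count w z ≤ suc (length V)) (map-id (shuffle p V)) (offset-count 0 V refl z≤n)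
        where
        open ≤-Reasoning
        lower : 1 ≤ count w (shuffle p V)
        lower = begin
          1                                           ≡⟨ sym (suffix-count 1 p₁ refl (s≤s z≤n) V V-bounded) ⟩
          count (p₁ ++ V) (shuffle p₁ V)              ≡⟨ sym (count-map-++ (x₀ ∷ []) (p₁ ++ V) (shuffle p₁ V)) ⟩
          count w (map (x₀ ∷_) (shuffle p₁ V))        ≤⟨ m≤m+n _ _ ⟩
          count w (map (x₀ ∷_) (shuffle p₁ V)) + count w (shuffle-right p V)
                                                      ≡⟨ sym (count-++ w (map (x₀ ∷_) (shuffle p₁ V)) (shuffle-right p V)) ⟩
          count w (map (x₀ ∷_) (shuffle p₁ V) ++ shuffle-right p V)
                                                      ≡⟨ cong (count w) (sym (shuffle-∷ˡ x₀ p₁ V)) ⟩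
          count w (shuffle p V)                       ∎

module DuvalFactorisation {a ℓ : Level} {X : Set a} {_⊏_ : Rel X ℓ}
                          (sto : IsStrictTotalOrder _≡_ _⊏_) where

  open import Defs
  open import Data.Nat using (ℕ; zero; suc; _+_; _∸_; _≤_; _<_; z≤n; s≤s)
  open import Data.Nat.Properties
    using (+-identityʳ; +-suc; +-comm; ≤-refl; ≤-pred; m<m+n; m<n+m; n≤1+n;
           m+[n∸m]≡n; m≤n⇒m<n∨m≡n; m≤n⇒∃[o]m+o≡n; m≤n+m)
  open import Data.Nat.Induction using (<-wellFounded)
  open import Data.Product using (_×_; _,_; Σ-syntax; proj₂)
  open import Data.Sum using (inj₁; inj₂)
  open import Data.List using ([]; _∷_; _++_; length; drop)
  open import Data.List.Properties using (++-assoc; length-++; ++-identityʳ; ∷-injectiveˡ; ∷ʳ-injective)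
  open import Induction.WellFounded using (Acc; acc)

  open IsStrictTotalOrder sto using () renaming (trans to ⊏-trans)
  open ListLemmas
  open WordOrder sto
  open Periodic sto
  open WindowMerges sto
  open Sh sto using (Word; Lyndon; NonEmpty; _<alp_)

  letter-lyndon : ∀ x → Lyndon (x ∷ [])
  letter-lyndon x = (x , [] , refl) , no-split
    where
    no-split : ∀ u v → (x ∷ []) ≡ u ++ v → NonEmpty u → NonEmpty v → (x ∷ []) <alp v
    no-split [] v e (y , u' , ()) nv
    no-split (y ∷ []) [] e nu (z , v' , ())
    no-split (y ∷ y' ∷ u) v () nu nv

  drop-length-++ : ∀ (xs u v : Word) → xs ≡ u ++ v → v ≡ drop (length u) xs
  drop-length-++ xs u v refl = sym (drop-++-length u v refl)

  record LyndonFactorisation (w : Word) : Set (a ⊔ ℓ) where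
    field
      x₀ : X
      p₁ : Word
      lyn : Lyndon (x₀ ∷ p₁)
      L : ℕ
      R : Word
      R-below : StartsBelow (Period.p^ω x₀ p₁ L) R
      w≡ : w ≡ (x₀ ∷ p₁) ++ (Period.window x₀ p₁ 0 L ++ R)

  module Splitting (x₀ : X) (p₁ : Word) where
    open Period x₀ p₁

    ≺-window⇒split : ∀ k n xs → xs ≺ window k n →
                     Σ[ L ∈ ℕ ] Σ[ c ∈ X ] Σ[ R' ∈ Word ] (xs ≡ window k L ++ c ∷ R' × c ⊏ p^ω (k + L))
    ≺-window⇒split k (suc n) (x ∷ xs) (≺-head h) = 0 , x , xs , refl , subst (x ⊏_) (cong p^ω (sym (+-identityʳ k))) h
    ≺-window⇒split k (suc n) (x ∷ xs) (≺-tail h) with ≺-window⇒split (suc k) n xs h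
    ... | L , c , R' , xs≡ , c⊏ = suc L , c , R' , cong (x ∷_) xs≡ , subst (c ⊏_) (cong p^ω (sym (+-suc k L))) c⊏

    window-≺⇒split : ∀ k n xs → window k n ≺ xs →
                     Σ[ L ∈ ℕ ] Σ[ c ∈ X ] Σ[ R' ∈ Word ] (xs ≡ window k L ++ c ∷ R' × p^ω (k + L) ⊏ c)
    window-≺⇒split k (suc n) (x ∷ xs) (≺-head h) = 0 , x , xs , refl , subst (_⊏ x) (cong p^ω (sym (+-identityʳ k))) h
    window-≺⇒split k (suc n) (x ∷ xs) (≺-tail h) with window-≺⇒split (suc k) n xs h
    ... | L , c , R' , xs≡ , ⊏c = suc L , c , R' , cong (p^ω k ∷_) xs≡ , subst (_⊏ c) (cong p^ω (sym (+-suc k L))) ⊏c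

    last-p^ω : ∀ k j → window k (suc j) ≡ window 0 (suc j) → p^ω (k + j) ≡ p^ω j
    last-p^ω k j e = proj₂ (∷ʳ-injective (window k j) (window 0 j) (trans (sym (split k)) (trans e (split 0))))
      where
      split : ∀ i → window i (suc j) ≡ window i j ++ p^ω (i + j) ∷ []
      split i = trans (cong (window i) (+-comm 1 j)) (window-split i j 0)

    aligned-suffix-≺ : ∀ n k j c → j < n → window k j ≡ window 0 j → p^ω j ⊏ c →
                       window 0 n ++ c ∷ [] ≺ window k j ++ c ∷ []
    aligned-suffix-≺ n k j c j<n wk j⊏c with m≤n⇒∃[o]m+o≡n j<n
    ... | r , refl = subst₂ _≺_ (sym W≡) (cong (_++ c ∷ []) (sym wk)) (++-≺ (window 0 j) (≺-head j⊏c))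
      where
      W≡ : window 0 (suc j + r) ++ c ∷ [] ≡ window 0 j ++ p^ω j ∷ (window (suc j) r ++ c ∷ [])
      W≡ = trans (cong (λ z → window 0 z ++ c ∷ []) (sym (+-suc j r)))
                 (trans (cong (_++ c ∷ []) (window-split 0 j r)) (++-assoc (window 0 j) _ (c ∷ [])))

    module Extension (lyn : Lyndon p) where
      open LyndonWindows x₀ p₁ lyn

      extension-suffix-≺ : ∀ n c → p^ω n ⊏ c → ∀ k j → 0 < k → k + j ≡ n →
                           window 0 n ++ c ∷ [] ≺ window k j ++ c ∷ []
      extension-suffix-≺ n c n⊏c k j 0<k refl with window-compare k (suc j)
      ... | inj₁ aligned =
        aligned-suffix-≺ (k + j) k j c (m<n+m j 0<k) (window-agree k (suc j) j aligned (n≤1+n j))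
                         (subst (_⊏ c) (last-p^ω k j aligned) n⊏c)
      ... | inj₂ (d , d<1+j , wk , pd) with m≤n⇒m<n∨m≡n (≤-pred d<1+j)
      ...   | inj₂ refl = aligned-suffix-≺ (k + d) k d c (m<n+m d 0<k) wk (⊏-trans pd n⊏c)
      ...   | inj₁ d<j = ≺-take⁻ j (subst₂ _≺_ (sym (take-window-++ 0 (k + j) (c ∷ []) j (m≤n+m j k)))
                                               (sym (take-window-++ k j (c ∷ []) j ≤-refl))
                                               (window-≺ k d j wk pd d<j))

      lyndon-extension : ∀ n c → p^ω n ⊏ c → Lyndon (window 0 n ++ c ∷ [])
      lyndon-extension n c n⊏c = nonempty n , suffix-greater
        where
        nonempty : ∀ n → NonEmpty (window 0 n ++ c ∷ [])
        nonempty zero = c , [] , refl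
        nonempty (suc n) = p^ω 0 , window 1 n ++ c ∷ [] , refl
        suffix-greater : ∀ u v → window 0 n ++ c ∷ [] ≡ u ++ v → NonEmpty u → NonEmpty v → (window 0 n ++ c ∷ []) <alp v
        suffix-greater u v W≡ (y , u' , refl) (z , v' , refl) =
          ≺⇒Lex (subst (window 0 n ++ c ∷ [] ≺_) (sym v≡)
                  (extension-suffix-≺ n c n⊏c k (n ∸ k) (s≤s z≤n) (m+[n∸m]≡n k≤n)))
          where
          k : ℕ
          k = length (y ∷ u')
          length-W : n + 1 ≡ k + suc (length v')
          length-W = trans (sym (trans (length-++ (window 0 n)) (cong (_+ 1) (window-length 0 n))))
                           (trans (cong length W≡) (length-++ (y ∷ u')))
          k≤n : k ≤ n
          k≤n = ≤-pred (subst (k <_) (trans (sym length-W) (+-comm n 1)) (m<m+n k (s≤s z≤n)))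
          v≡ : z ∷ v' ≡ window k (n ∸ k) ++ c ∷ []
          v≡ = trans (drop-length-++ _ (y ∷ u') (z ∷ v') W≡) (drop-window-++ 0 n (c ∷ []) k k≤n)

    lyndon-extend : Lyndon p → ∀ L c → p^ω L ⊏ c → Lyndon (p ++ window 0 L ++ c ∷ [])
    lyndon-extend lyn L c L⊏c =
      subst Lyndon (trans (cong (_++ c ∷ []) (sym (p++window L))) (++-assoc p (window 0 L) (c ∷ [])))
            (Extension.lyndon-extension lyn (m + L) c (subst (_⊏ c) (sym (∷-injectiveˡ (window-shift L 1))) L⊏c))

    factorise-step : ∀ V → Lyndon p →
                     (∀ {p₁′} R' → length R' < length V → Lyndon (x₀ ∷ p₁′) → LyndonFactorisation ((x₀ ∷ p₁′) ++ R')) →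
                     LyndonFactorisation (p ++ V)
    factorise-step V lyn recurse with ≺-compare V (window 0 (length V)) (sym (window-length 0 _))
    ... | inj₁ below with ≺-window⇒split 0 (length V) V below
    ...   | L , c , R' , V≡ , c⊏ = record { x₀ = x₀ ; p₁ = p₁ ; lyn = lyn ; L = L ; R = c ∷ R'
                                         ; R-below = inj₂ (c , R' , refl , c⊏) ; w≡ = cong (p ++_) V≡ }
    factorise-step V lyn recurse | inj₂ (inj₁ V≡) =
      record { x₀ = x₀ ; p₁ = p₁ ; lyn = lyn ; L = length V ; R = []
             ; R-below = inj₁ refl ; w≡ = cong (p ++_) (trans V≡ (sym (++-identityʳ _))) }
    factorise-step V lyn recurse | inj₂ (inj₂ above) with window-≺⇒split 0 (length V) V above
    ... | L , c , R' , V≡ , ⊏c = subst LyndonFactorisation (sym reassociate) (recurse R' shorter (lyndon-extend lyn L c ⊏c))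
      where
      shorter : length R' < length V
      shorter = subst (length R' <_)
        (sym (trans (cong length V≡) (trans (length-++ (window 0 L)) (trans (cong (_+ suc (length R')) (window-length 0 L)) (+-suc L _)))))
        (s≤s (m≤n+m (length R') L))
      reassociate : p ++ V ≡ (p ++ window 0 L ++ c ∷ []) ++ R'
      reassociate = trans (cong (p ++_) (trans V≡ (sym (++-assoc (window 0 L) (c ∷ []) R'))))
                          (sym (++-assoc p (window 0 L ++ c ∷ []) R'))

  factorise′ : ∀ x₀ p₁ V → Acc _<_ (length V) → Lyndon (x₀ ∷ p₁) → LyndonFactorisation ((x₀ ∷ p₁) ++ V)
  factorise′ x₀ p₁ V (acc rs) lyn = Splitting.factorise-step x₀ p₁ V lyn (λ R' shorter → factorise′ x₀ _ R' (rs shorter))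

  factorise : ∀ x ys → LyndonFactorisation (x ∷ ys)
  factorise x ys = factorise′ x [] ys (<-wellFounded _) (letter-lyndon x)

module Span {a ℓ : Level} {X : Set a} {_⊏_ : Rel X ℓ}
            (sto : IsStrictTotalOrder _≡_ _⊏_) where

  open import Defs
  open import Data.Nat as ℕ using (ℕ)
  open import Data.Integer using (ℤ; _+_; _*_) renaming (+_ to ℤ+_)
  open import Data.Integer.Properties using (+-identityˡ; +-identityʳ; +-assoc; *-zeroʳ; *-identityˡ; *-identityʳ; *-assoc; *-distribˡ-+)
  open import Data.Integer.Solver using (module +-*-Solver)
  open import Data.Product using (_×_; _,_)
  open import Data.List using (List; []; _∷_; _++_; map; length)
  open import Data.List.Properties using (≡-dec)
  open import Data.List.Relation.Unary.All using (All; []; _∷_)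
  import Data.List.Relation.Unary.All.Properties as All
  open import Relation.Nullary using (yes; no)

  open IsStrictTotalOrder sto using (_≟_)
  open WordOrder sto using (count)
  open Sh sto

  ones : List Word → FreeZ
  ones = map (λ t → (ℤ+ 1 , t))

  coeff-++ : ∀ f g x → coeff (f ++ g) x ≡ coeff f x + coeff g x
  coeff-++ [] g x = sym (+-identityˡ _)
  coeff-++ ((c , v) ∷ f) g x with ≡-dec _≟_ v x
  ... | yes _ = trans (cong (c +_) (coeff-++ f g x)) (sym (+-assoc c _ _))
  ... | no _ = coeff-++ f g x

  coeff-· : ∀ c f x → coeff (c · f) x ≡ c * coeff f x
  coeff-· c [] x = sym (*-zeroʳ c)
  coeff-· c ((d , v) ∷ f) x with ≡-dec _≟_ v x
  ... | yes _ = trans (cong (c * d +_) (coeff-· c f x)) (sym (*-distribˡ-+ c d _))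
  ... | no _ = coeff-· c f x

  coeff-single : ∀ c w x → coeff ((c , w) ∷ []) x ≡ coeff (c · ((ℤ+ 1 , w) ∷ [])) x
  coeff-single c w x with ≡-dec _≟_ w x
  ... | yes _ = cong (_+ ℤ+ 0) (sym (*-identityʳ c))
  ... | no _ = refl

  coeff-ones : ∀ ts x → coeff (ones ts) x ≡ ℤ+ count x ts
  coeff-ones [] x = refl
  coeff-ones (t ∷ ts) x with ≡-dec _≟_ t x
  ... | yes _ = cong (ℤ+ 1 +_) (coeff-ones ts x)
  ... | no _ = coeff-ones ts x

  coeff-shSum-++ : ∀ d₁ d₂ x → coeff (shSum (d₁ ++ d₂)) x ≡ coeff (shSum d₁) x + coeff (shSum d₂) x
  coeff-shSum-++ [] d₂ x = sym (+-identityˡ _)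
  coeff-shSum-++ ((d , u , v) ∷ d₁) d₂ x = begin
    coeff (d · sh u v ++ shSum (d₁ ++ d₂)) x                              ≡⟨ coeff-++ (d · sh u v) _ x ⟩
    coeff (d · sh u v) x + coeff (shSum (d₁ ++ d₂)) x                     ≡⟨ cong (coeff (d · sh u v) x +_) (coeff-shSum-++ d₁ d₂ x) ⟩
    coeff (d · sh u v) x + (coeff (shSum d₁) x + coeff (shSum d₂) x)      ≡⟨ sym (+-assoc (coeff (d · sh u v) x) _ _) ⟩
    coeff (d · sh u v) x + coeff (shSum d₁) x + coeff (shSum d₂) x        ≡⟨ cong (_+ coeff (shSum d₂) x) (sym (coeff-++ (d · sh u v) (shSum d₁) x)) ⟩
    coeff (d · sh u v ++ shSum d₁) x + coeff (shSum d₂) x                 ∎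
    where open ≡-Reasoning

  scaleTerms : ℤ → List (ℤ × Word × Word) → List (ℤ × Word × Word)
  scaleTerms c = map (λ { (d , u , v) → (c * d , u , v) })

  coeff-shSum-scale : ∀ c ds x → coeff (shSum (scaleTerms c ds)) x ≡ c * coeff (shSum ds) x
  coeff-shSum-scale c [] x = sym (*-zeroʳ c)
  coeff-shSum-scale c ((d , u , v) ∷ ds) x = begin
    coeff ((c * d) · sh u v ++ shSum (scaleTerms c ds)) x                  ≡⟨ coeff-++ ((c * d) · sh u v) _ x ⟩
    coeff ((c * d) · sh u v) x + coeff (shSum (scaleTerms c ds)) x        ≡⟨ cong₂ _+_ (coeff-· (c * d) (sh u v) x) (coeff-shSum-scale c ds x) ⟩
    c * d * coeff (sh u v) x + c * coeff (shSum ds) x                     ≡⟨ cong (_+ c * coeff (shSum ds) x) (trans (*-assoc c d _) (cong (c *_) (sym (coeff-· d (sh u v) x)))) ⟩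
    c * coeff (d · sh u v) x + c * coeff (shSum ds) x                     ≡⟨ sym (*-distribˡ-+ c _ _) ⟩
    c * (coeff (d · sh u v) x + coeff (shSum ds) x)                       ≡⟨ cong (c *_) (sym (coeff-++ (d · sh u v) (shSum ds) x)) ⟩
    c * coeff (d · sh u v ++ shSum ds) x                                  ∎
    where open ≡-Reasoning

  -- Spanned f says that the image of f in Sh(X)_indec,s ⊗ ℤ/r lies in the span of the Lyndon words.
  module Spanning (s r : ℕ) where

    LyndonTerm : ℤ × Word → Set (a ⊔ ℓ)
    LyndonTerm (_ , w) = Lyndon w × length w ≡ s

    ShuffleTerm : ℤ × Word × Word → Set a
    ShuffleTerm (_ , u , v) = NonEmpty u × NonEmpty v × length u ℕ.+ length v ≡ s

    HomogeneousTerm : ℤ × Word → Set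
    HomogeneousTerm (_ , w) = length w ≡ s

    combination : FreeZ → List (ℤ × Word × Word) → FreeZ → FreeZ
    combination lyn dec z = lyn ++ (shSum dec ++ (ℤ+ r) · z)

    record Spanned (f : FreeZ) : Set (a ⊔ ℓ) where
      field
        lyn : FreeZ
        dec : List (ℤ × Word × Word)
        z : FreeZ
        lyn-terms : All LyndonTerm lyn
        dec-terms : All ShuffleTerm dec
        z-terms : All HomogeneousTerm z
        f≈ : f ≈ combination lyn dec z

    coeff-combination : ∀ l d z x → coeff (combination l d z) x ≡ coeff l x + (coeff (shSum d) x + ℤ+ r * coeff z x)
    coeff-combination l d z x =
      trans (coeff-++ l _ x) (cong (coeff l x +_) (trans (coeff-++ (shSum d) _ x) (cong (coeff (shSum d) x +_) (coeff-· (ℤ+ r) z x))))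

    spanned-cong : ∀ {f g} → f ≈ g → Spanned g → Spanned f
    spanned-cong f≈g sg = record { Spanned sg ; f≈ = λ x → trans (f≈g x) (Spanned.f≈ sg x) }

    spanned-[] : Spanned []
    spanned-[] = record { lyn = [] ; dec = [] ; z = [] ; lyn-terms = [] ; dec-terms = [] ; z-terms = [] ; f≈ = λ _ → refl }

    spanned-++ : ∀ {f g} → Spanned f → Spanned g → Spanned (f ++ g)
    spanned-++ {f} {g} sf sg = record
      { lyn = F.lyn ++ G.lyn ; dec = F.dec ++ G.dec ; z = F.z ++ G.z
      ; lyn-terms = All.++⁺ F.lyn-terms G.lyn-terms ; dec-terms = All.++⁺ F.dec-terms G.dec-terms ; z-terms = All.++⁺ F.z-terms G.z-terms
      ; f≈ = λ x → begin
          coeff (f ++ g) x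
            ≡⟨ coeff-++ f g x ⟩
          coeff f x + coeff g x
            ≡⟨ cong₂ _+_ (trans (F.f≈ x) (coeff-combination F.lyn F.dec F.z x)) (trans (G.f≈ x) (coeff-combination G.lyn G.dec G.z x)) ⟩
          (coeff F.lyn x + (coeff (shSum F.dec) x + ℤ+ r * coeff F.z x)) + (coeff G.lyn x + (coeff (shSum G.dec) x + ℤ+ r * coeff G.z x))
            ≡⟨ regroup (coeff F.lyn x) (coeff (shSum F.dec) x) (coeff F.z x) (coeff G.lyn x) (coeff (shSum G.dec) x) (coeff G.z x) ⟩
          (coeff F.lyn x + coeff G.lyn x) + ((coeff (shSum F.dec) x + coeff (shSum G.dec) x) + ℤ+ r * (coeff F.z x + coeff G.z x))
            ≡⟨ sym (cong₂ _+_ (coeff-++ F.lyn G.lyn x) (cong₂ _+_ (coeff-shSum-++ F.dec G.dec x) (cong (ℤ+ r *_) (coeff-++ F.z G.z x)))) ⟩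
          coeff (F.lyn ++ G.lyn) x + (coeff (shSum (F.dec ++ G.dec)) x + ℤ+ r * coeff (F.z ++ G.z) x)
            ≡⟨ sym (coeff-combination (F.lyn ++ G.lyn) (F.dec ++ G.dec) (F.z ++ G.z) x) ⟩
          coeff (combination (F.lyn ++ G.lyn) (F.dec ++ G.dec) (F.z ++ G.z)) x ∎ }
      where
      module F = Spanned sf
      module G = Spanned sg
      open ≡-Reasoning
      regroup : ∀ a₁ b₁ c₁ a₂ b₂ c₂ → (a₁ + (b₁ + ℤ+ r * c₁)) + (a₂ + (b₂ + ℤ+ r * c₂)) ≡ (a₁ + a₂) + ((b₁ + b₂) + ℤ+ r * (c₁ + c₂))
      regroup = solve 7 (λ R a₁ b₁ c₁ a₂ b₂ c₂ → (a₁ :+ (b₁ :+ R :* c₁)) :+ (a₂ :+ (b₂ :+ R :* c₂))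
                                                 := (a₁ :+ a₂) :+ ((b₁ :+ b₂) :+ R :* (c₁ :+ c₂))) refl (ℤ+ r)
        where open +-*-Solver

    spanned-· : ∀ c {f} → Spanned f → Spanned (c · f)
    spanned-· c {f} sf = record
      { lyn = c · lyn ; dec = scaleTerms c dec ; z = c · z
      ; lyn-terms = All.map⁺ lyn-terms ; dec-terms = All.map⁺ (scaled dec dec-terms) ; z-terms = All.map⁺ z-terms
      ; f≈ = λ x → begin
          coeff (c · f) x                                                  ≡⟨ coeff-· c f x ⟩
          c * coeff f x                                                    ≡⟨ cong (c *_) (trans (f≈ x) (coeff-combination lyn dec z x)) ⟩
          c * (coeff lyn x + (coeff (shSum dec) x + ℤ+ r * coeff z x))     ≡⟨ distribute (coeff lyn x) (coeff (shSum dec) x) (coeff z x) ⟩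
          c * coeff lyn x + (c * coeff (shSum dec) x + ℤ+ r * (c * coeff z x))
            ≡⟨ sym (cong₂ _+_ (coeff-· c lyn x) (cong₂ _+_ (coeff-shSum-scale c dec x) (cong (ℤ+ r *_) (coeff-· c z x)))) ⟩
          coeff (c · lyn) x + (coeff (shSum (scaleTerms c dec)) x + ℤ+ r * coeff (c · z) x)
            ≡⟨ sym (coeff-combination (c · lyn) (scaleTerms c dec) (c · z) x) ⟩
          coeff (combination (c · lyn) (scaleTerms c dec) (c · z)) x ∎ }
      where
      open Spanned sf
      open ≡-Reasoning
      scaled : ∀ ds → All ShuffleTerm ds → All (λ { (d , u , v) → ShuffleTerm (c * d , u , v) }) ds
      scaled [] [] = []
      scaled (_ ∷ ds) (h ∷ hs) = h ∷ scaled ds hs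
      distribute : ∀ a₁ b₁ c₁ → c * (a₁ + (b₁ + ℤ+ r * c₁)) ≡ c * a₁ + (c * b₁ + ℤ+ r * (c * c₁))
      distribute = solve 5 (λ C R a₁ b₁ c₁ → C :* (a₁ :+ (b₁ :+ R :* c₁)) := C :* a₁ :+ (C :* b₁ :+ R :* (C :* c₁))) refl c (ℤ+ r)
        where open +-*-Solver

    spanned-shuffle : ∀ u v → NonEmpty u → NonEmpty v → length u ℕ.+ length v ≡ s → Spanned (sh u v)
    spanned-shuffle u v nu nv uv≡s = record
      { lyn = [] ; dec = (ℤ+ 1 , u , v) ∷ [] ; z = [] ; lyn-terms = [] ; dec-terms = (nu , nv , uv≡s) ∷ [] ; z-terms = []
      ; f≈ = λ x → sym (trans (coeff-++ ((ℤ+ 1) · sh u v ++ []) [] x) (trans (+-identityʳ _) (trans (coeff-++ ((ℤ+ 1) · sh u v) [] x)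
                        (trans (+-identityʳ _) (trans (coeff-· (ℤ+ 1) (sh u v) x) (*-identityˡ _)))))) }

    spanned-multiple : ∀ β w → length w ≡ s → Spanned ((ℤ+ r) · ((β , w) ∷ []))
    spanned-multiple β w w≡s = record
      { lyn = [] ; dec = [] ; z = (β , w) ∷ [] ; lyn-terms = [] ; dec-terms = [] ; z-terms = w≡s ∷ [] ; f≈ = λ _ → refl }

    spanned-lyndon : ∀ w → Lyndon w → length w ≡ s → Spanned ((ℤ+ 1 , w) ∷ [])
    spanned-lyndon w lw w≡s = record
      { lyn = (ℤ+ 1 , w) ∷ [] ; dec = [] ; z = [] ; lyn-terms = (lw , w≡s) ∷ [] ; dec-terms = [] ; z-terms = [] ; f≈ = λ _ → refl }

    spanned-ones : ∀ ts → All (λ t → Spanned ((ℤ+ 1 , t) ∷ [])) ts → Spanned (ones ts)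
    spanned-ones [] [] = spanned-[]
    spanned-ones (t ∷ ts) (h ∷ hs) = spanned-++ h (spanned-ones ts hs)

module Coprimality where

  open import Data.Nat as ℕ using (ℕ; zero; suc; _≤_; _<_; >-nonZero)
  open import Data.Nat.Properties using (<⇒≢; <⇒≱; ≤-trans)
  open import Data.Nat.Divisibility using (_∣_; ∣⇒≤; ∣-trans; m∣m*n; 0∣⇒≡0)
  open import Data.Nat.Primality using (Prime)
  open import Data.Nat.Primality.Factorisation using (factorise)
  open import Data.Nat.ListAction using (product)
  open import Data.Nat.Coprimality using (Coprime; coprime-Bézout)
  open import Data.Nat.GCD using (module Bézout)
  open import Data.Integer using (ℤ; -_; _+_; _*_) renaming (+_ to ℤ+_)
  open import Data.Integer.Properties using (pos-*; pos-+; +-comm)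
  open import Data.Integer.Solver using (module +-*-Solver)
  open import Data.Product using (_,_; Σ-syntax)
  open import Data.List using (_∷_)
  open import Data.List.Relation.Unary.All using (_∷_)
  open import Data.Empty using (⊥-elim)

  coprime-if-small : ∀ N s r → 1 ≤ N → N ≤ s → (∀ p → Prime p → p ∣ r → s < p) → Coprime N r
  coprime-if-small N s r 1≤N N≤s r-rough {d} (d∣N , d∣r) with d
  ... | zero = ⊥-elim (<⇒≢ 1≤N (sym (0∣⇒≡0 d∣N)))
  ... | suc zero = refl
  ... | suc (suc k) with factorise (suc (suc k))
  ...   | record { factors = q ∷ qs ; isFactorisation = d≡ ; factorsPrime = q-prime ∷ _ } =
    ⊥-elim (<⇒≱ (r-rough q q-prime (∣-trans q∣d d∣r)) (≤-trans (∣⇒≤ q∣d) (≤-trans (∣⇒≤ ⦃ >-nonZero 1≤N ⦄ d∣N) N≤s)))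
    where
    q∣d : q ∣ suc (suc k)
    q∣d = subst (q ∣_) (sym d≡) (m∣m*n (product qs))

  identity-from-ℕ : ∀ a m b n → 1 ℕ.+ b ℕ.* n ≡ a ℕ.* m → ℤ+ a * ℤ+ m + - ℤ+ b * ℤ+ n ≡ ℤ+ 1
  identity-from-ℕ a m b n e = begin
    ℤ+ a * ℤ+ m + - ℤ+ b * ℤ+ n              ≡⟨ cong (_+ - ℤ+ b * ℤ+ n) am≡ ⟩
    ℤ+ 1 + ℤ+ b * ℤ+ n + - ℤ+ b * ℤ+ n       ≡⟨ solve 2 (λ B N → con (ℤ+ 1) :+ B :* N :+ (:- B) :* N := con (ℤ+ 1)) refl (ℤ+ b) (ℤ+ n) ⟩
    ℤ+ 1                                     ∎
    where
    open ≡-Reasoning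
    open +-*-Solver
    am≡ : ℤ+ a * ℤ+ m ≡ ℤ+ 1 + ℤ+ b * ℤ+ n
    am≡ = trans (sym (pos-* a m)) (trans (cong ℤ+_ (sym e)) (trans (pos-+ 1 (b ℕ.* n)) (cong (ℤ+ 1 +_) (pos-* b n))))

  bézout-ℤ : ∀ N r → Coprime N r → Σ[ α ∈ ℤ ] Σ[ β ∈ ℤ ] (α * ℤ+ N + β * ℤ+ r ≡ ℤ+ 1)
  bézout-ℤ N r c with coprime-Bézout c
  ... | Bézout.+- x y e = ℤ+ x , - ℤ+ y , identity-from-ℕ x N y r e
  ... | Bézout.-+ x y e = - ℤ+ x , ℤ+ y , trans (+-comm (- ℤ+ x * ℤ+ N) (ℤ+ y * ℤ+ r)) (identity-from-ℕ y r x N e)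

module Reduction {a ℓ : Level} {X : Set a} {_⊏_ : Rel X ℓ}
                 (sto : IsStrictTotalOrder _≡_ _⊏_) where

  open import Defs
  open import Data.Nat as ℕ using (ℕ; suc; _^_; _≤_; _<_; z≤n; s≤s)
  open import Data.Nat.Properties
    using (≤-trans; <-≤-trans; <⇒≢; m≤n⇒m≤1+n; +-monoʳ-<; *-monoˡ-≤; +-comm; m≤m+n; suc-injective; m≤n+m)
  open import Data.Nat.Divisibility using (_∣_)
  open import Data.Nat.Primality using (Prime)
  open import Data.Integer using (ℤ; -_; _+_; _*_) renaming (+_ to ℤ+_)
  open import Data.Integer.Properties using (+-identityˡ; +-identityʳ)
  open import Data.Integer.Solver using (module +-*-Solver)
  open import Data.Product using (_×_; _,_; Σ-syntax; proj₁; proj₂)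
  open import Data.Sum using (_⊎_; inj₁; inj₂)
  open import Data.Empty using (⊥-elim)
  open import Data.List using (List; []; _∷_; _++_; length)
  open import Data.List.Properties using (≡-dec; ++-identityʳ; length-++)
  open import Data.List.Relation.Unary.All using (All; []; _∷_)
  import Data.List.Relation.Unary.All as All
  import Data.List.Relation.Unary.All.Properties as All
  open import Data.List.Membership.Propositional using (_∈_)
  open import Data.List.Relation.Unary.Any using (here; there)
  open import Induction.WellFounded using (Acc; acc)
  open import Data.Nat.Induction using (<-wellFounded)
  open import Relation.Nullary using (¬_; yes; no)

  open IsStrictTotalOrder sto using (_≟_; _<?_) renaming (trans to ⊏-trans; irrefl to ⊏-irrefl)
  open WordOrder sto
  open Periodic sto
  open Maximality sto
  open DuvalFactorisation sto
  open Span sto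
  open Sh sto
  open Coprimality

  -- Words over the finite alphabet Λ, read as numerals in base |Λ| + 1, strictly
  -- increase along ≺; this is the well-founded measure of the reduction.
  module LexValue (Λ : List X) where

    rank : X → List X → ℕ
    rank x [] = 0
    rank x (y ∷ ys) with y <? x
    ... | yes _ = suc (rank x ys)
    ... | no _ = rank x ys

    rank-≤ : ∀ x ys → rank x ys ≤ length ys
    rank-≤ x [] = z≤n
    rank-≤ x (y ∷ ys) with y <? x
    ... | yes _ = s≤s (rank-≤ x ys)
    ... | no _ = m≤n⇒m≤1+n (rank-≤ x ys)

    rank-mono : ∀ {x y} ys → x ⊏ y → rank x ys ≤ rank y ys
    rank-mono [] h = z≤n
    rank-mono {x} {y} (z ∷ ys) h with z <? x | z <? y
    ... | yes _ | yes _ = s≤s (rank-mono ys h)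
    ... | yes z⊏x | no z⋢y = ⊥-elim (z⋢y (⊏-trans z⊏x h))
    ... | no _ | yes _ = m≤n⇒m≤1+n (rank-mono ys h)
    ... | no _ | no _ = rank-mono ys h

    rank-strict : ∀ {x y} ys → x ∈ ys → x ⊏ y → rank x ys < rank y ys
    rank-strict {x} {y} (z ∷ ys) (here refl) h with z <? x | z <? y
    ... | yes z⊏x | _ = ⊥-elim (⊏-irrefl refl z⊏x)
    ... | no _ | yes _ = s≤s (rank-mono ys h)
    ... | no _ | no z⋢y = ⊥-elim (z⋢y h)
    rank-strict {x} {y} (z ∷ ys) (there x∈ys) h with z <? x | z <? y
    ... | yes _ | yes _ = s≤s (rank-strict ys x∈ys h)
    ... | yes z⊏x | no z⋢y = ⊥-elim (z⋢y (⊏-trans z⊏x h))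
    ... | no _ | yes _ = m≤n⇒m≤1+n (rank-strict ys x∈ys h)
    ... | no _ | no _ = rank-strict ys x∈ys h

    base : ℕ
    base = suc (length Λ)

    value : Word → ℕ
    value [] = 0
    value (x ∷ t) = rank x Λ ℕ.* base ^ length t ℕ.+ value t

    value<base^length : ∀ t → value t < base ^ length t
    value<base^length [] = s≤s z≤n
    value<base^length (x ∷ t) = <-≤-trans (+-monoʳ-< (rank x Λ ℕ.* base ^ length t) (value<base^length t))
      (subst (_≤ base ^ suc (length t)) (+-comm (base ^ length t) (rank x Λ ℕ.* base ^ length t))
             (*-monoˡ-≤ (base ^ length t) (s≤s (rank-≤ x Λ))))

    ≺⇒value< : ∀ t w → length t ≡ length w → All (_∈ Λ) t → t ≺ w → value t < value w
    ≺⇒value< (x ∷ t) (y ∷ w) e (x∈Λ ∷ _) (≺-head h) =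
      <-≤-trans (+-monoʳ-< (rank x Λ ℕ.* base ^ length t) (value<base^length t))
        (≤-trans (subst (_≤ rank y Λ ℕ.* base ^ length t) (+-comm (base ^ length t) (rank x Λ ℕ.* base ^ length t))
                        (*-monoˡ-≤ (base ^ length t) (rank-strict Λ x∈Λ h)))
                 (subst (λ n → rank y Λ ℕ.* base ^ length t ≤ rank y Λ ℕ.* base ^ n ℕ.+ value w) (suc-injective e) (m≤m+n _ _)))
    ≺⇒value< (x ∷ t) (.x ∷ w) e (_ ∷ t∈Λ) (≺-tail h) =
      subst (λ n → rank x Λ ℕ.* base ^ length t ℕ.+ value t < rank x Λ ℕ.* base ^ n ℕ.+ value w) (suc-injective e)
        (+-monoʳ-< (rank x Λ ℕ.* base ^ length t) (≺⇒value< t w (suc-injective e) t∈Λ h))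

  without : Word → List Word → List Word
  without w [] = []
  without w (t ∷ ts) with ≡-dec _≟_ t w
  ... | yes _ = without w ts
  ... | no _ = t ∷ without w ts

  All-without : ∀ {p} {P : Word → Set p} w ts → All P ts → All P (without w ts)
  All-without w [] [] = []
  All-without w (t ∷ ts) (h ∷ hs) with ≡-dec _≟_ t w
  ... | yes _ = All-without w ts hs
  ... | no _ = h ∷ All-without w ts hs

  All-without-≺ : ∀ w ts → All (_≼ w) ts → All (_≺ w) (without w ts)
  All-without-≺ w [] [] = []
  All-without-≺ w (t ∷ ts) (h ∷ hs) with ≡-dec _≟_ t w | h
  ... | yes _ | _ = All-without-≺ w ts hs
  ... | no t≢w | inj₁ t≡w = ⊥-elim (t≢w t≡w)
  ... | no _ | inj₂ t≺w = t≺w ∷ All-without-≺ w ts hs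

  count-without-self : ∀ w ts → count w (without w ts) ≡ 0
  count-without-self w [] = refl
  count-without-self w (t ∷ ts) with ≡-dec _≟_ t w
  ... | yes _ = count-without-self w ts
  ... | no t≢w with ≡-dec _≟_ t w
  ...   | yes t≡w = ⊥-elim (t≢w t≡w)
  ...   | no _ = count-without-self w ts

  count-without-other : ∀ w x ts → ¬ (w ≡ x) → count x (without w ts) ≡ count x ts
  count-without-other w x [] _ = refl
  count-without-other w x (t ∷ ts) w≢x with ≡-dec _≟_ t w
  ... | yes refl with ≡-dec _≟_ t x
  ...   | yes w≡x = ⊥-elim (w≢x w≡x)
  ...   | no _ = count-without-other w x ts w≢x
  count-without-other w x (t ∷ ts) w≢x | no _ with ≡-dec _≟_ t x
  ...   | yes _ = cong suc (count-without-other w x ts w≢x)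
  ...   | no _ = count-without-other w x ts w≢x

  count-split : ∀ w ts x → ℤ+ count x ts ≡ coeff ((ℤ+ count w ts , w) ∷ []) x + ℤ+ count x (without w ts)
  count-split w ts x with ≡-dec _≟_ w x
  ... | yes refl = sym (trans (cong (λ z → ℤ+ count w ts + ℤ+ 0 + ℤ+ z) (count-without-self w ts))
                              (trans (+-identityʳ _) (+-identityʳ _)))
  ... | no w≢x = trans (cong ℤ+_ (sym (count-without-other w x ts w≢x))) (sym (+-identityˡ _))

  nonempty? : ∀ (v : Word) → v ≡ [] ⊎ NonEmpty v
  nonempty? [] = inj₁ refl
  nonempty? (x ∷ v) = inj₂ (x , v , refl)

  module Reduce (s r : ℕ) (1≤s : 1 ≤ s) (r-rough : ∀ p → Prime p → p ∣ r → s < p) where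
    open Spanning s r

    isolate : ∀ w ts α β → α * ℤ+ (count w ts) + β * ℤ+ r ≡ ℤ+ 1 →
              ((ℤ+ 1 , w) ∷ []) ≈ (α · ones ts ++ ((- α) · ones (without w ts) ++ (ℤ+ r) · ((β , w) ∷ [])))
    isolate w ts α β αN+βr≡1 x = sym (begin
      coeff (α · ones ts ++ ((- α) · ones (without w ts) ++ (ℤ+ r) · ((β , w) ∷ []))) x
        ≡⟨ coeff-++ (α · ones ts) _ x ⟩
      coeff (α · ones ts) x + coeff ((- α) · ones (without w ts) ++ (ℤ+ r) · ((β , w) ∷ [])) x
        ≡⟨ cong₂ _+_ (coeff-· α (ones ts) x) (coeff-++ ((- α) · ones (without w ts)) _ x) ⟩
      α * coeff (ones ts) x + (coeff ((- α) · ones (without w ts)) x + coeff ((ℤ+ r) · ((β , w) ∷ [])) x)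
        ≡⟨ cong₂ (λ u v → α * u + v) (trans (coeff-ones ts x) (count-split w ts x))
                 (cong₂ _+_ (trans (coeff-· (- α) (ones (without w ts)) x) (cong ((- α) *_) (coeff-ones (without w ts) x)))
                            (coeff-· (ℤ+ r) ((β , w) ∷ []) x)) ⟩
      α * (coeff ((ℤ+ count w ts , w) ∷ []) x + M) + ((- α) * M + ℤ+ r * coeff ((β , w) ∷ []) x)
        ≡⟨ at-x ⟩
      coeff ((ℤ+ 1 , w) ∷ []) x ∎)
      where
      open ≡-Reasoning
      open +-*-Solver
      M : ℤ
      M = ℤ+ count x (without w ts)
      at-x : α * (coeff ((ℤ+ count w ts , w) ∷ []) x + M) + ((- α) * M + ℤ+ r * coeff ((β , w) ∷ []) x) ≡ coeff ((ℤ+ 1 , w) ∷ []) x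
      at-x with ≡-dec _≟_ w x
      ... | yes _ = trans (solve 5 (λ A N O B R → A :* ((N :+ con (ℤ+ 0)) :+ O) :+ ((:- A) :* O :+ R :* (B :+ con (ℤ+ 0)))
                                                := A :* N :+ B :* R) refl α (ℤ+ count w ts) M β (ℤ+ r))
                          (trans αN+βr≡1 (sym (+-identityʳ _)))
      ... | no _ = solve 3 (λ A O R → A :* (con (ℤ+ 0) :+ O) :+ ((:- A) :* O :+ R :* con (ℤ+ 0)) := con (ℤ+ 0)) refl α M (ℤ+ r)

    module FromFactorisation (Λ : List X) (x₀ : X) (p₁ : Word) (lyn : Lyndon (x₀ ∷ p₁))
                             (L : ℕ) (R : Word) (R-below : StartsBelow (Period.p^ω x₀ p₁ L) R) where
      open Period x₀ p₁ using (p)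
      open LyndonFactor x₀ p₁ lyn
      open Factored L R R-below

      Smaller : Set (a ⊔ ℓ)
      Smaller = ∀ t → t ≺ w → length t ≡ s → All (_∈ Λ) t → Spanned ((ℤ+ 1 , t) ∷ [])

      -- N ≤ s is invertible mod r, so w is isolated from p ш V modulo r and smaller words.
      spanned-non-lyndon : NonEmpty V → length w ≡ s → All (_∈ Λ) w → Smaller → Spanned ((ℤ+ 1 , w) ∷ [])
      spanned-non-lyndon V-nonempty w≡s w∈Λ smaller = spanned-cong (isolate w ts α β αN+βr≡1) combination-spanned
        where
        ts : List Word
        ts = shuffle p V
        N : ℕ
        N = count w ts
        p+V≡s : length p ℕ.+ length V ≡ s
        p+V≡s = trans (sym (length-++ p)) w≡s
        N≤s : N ≤ s
        N≤s = ≤-trans (proj₂ count-bounds) (subst (suc (length V) ≤_) p+V≡s (s≤s (m≤n+m (length V) (length p₁))))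
        coefficients : Σ[ α ∈ ℤ ] Σ[ β ∈ ℤ ] (α * ℤ+ N + β * ℤ+ r ≡ ℤ+ 1)
        coefficients = bézout-ℤ N r (coprime-if-small N s r (proj₁ count-bounds) N≤s r-rough)
        α β : ℤ
        α = proj₁ coefficients
        β = proj₁ (proj₂ coefficients)
        αN+βr≡1 : α * ℤ+ N + β * ℤ+ r ≡ ℤ+ 1
        αN+βr≡1 = proj₂ (proj₂ coefficients)
        term-facts : All (λ t → t ≼ w × length t ≡ s × All (_∈ Λ) t) ts
        term-facts = All-shuffle⁺ p V (λ t mg → shuffle-≼ t mg , trans (merge-length mg) p+V≡s
                                              , merge-All mg (All.++⁻ˡ p w∈Λ) (All.++⁻ʳ p w∈Λ))
        smaller-spanned : All (λ t → Spanned ((ℤ+ 1 , t) ∷ [])) (without w ts)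
        smaller-spanned = All.zipWith (λ {t} (t≺w , t≡s , t∈Λ) → smaller t t≺w t≡s t∈Λ)
          (All-without-≺ w ts (All.map proj₁ term-facts) , All-without w ts (All.map proj₂ term-facts))
        combination-spanned : Spanned (α · ones ts ++ ((- α) · ones (without w ts) ++ (ℤ+ r) · ((β , w) ∷ [])))
        combination-spanned =
          spanned-++ (spanned-· α (spanned-shuffle p V (x₀ , p₁ , refl) V-nonempty p+V≡s))
                     (spanned-++ (spanned-· (- α) (spanned-ones (without w ts) smaller-spanned)) (spanned-multiple β w w≡s))

      spanned-factorised : length w ≡ s → All (_∈ Λ) w → Smaller → Spanned ((ℤ+ 1 , w) ∷ [])
      spanned-factorised w≡s w∈Λ smaller with nonempty? V
      ... | inj₂ V-nonempty = spanned-non-lyndon V-nonempty w≡s w∈Λ smaller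
      ... | inj₁ V≡[] = spanned-lyndon w (subst Lyndon (sym (trans (cong (p ++_) V≡[]) (++-identityʳ p))) lyn) w≡s

    module OverAlphabet (Λ : List X) where
      open LexValue Λ

      spanned-word′ : ∀ w → Acc _<_ (value w) → length w ≡ s → All (_∈ Λ) w → Spanned ((ℤ+ 1 , w) ∷ [])
      spanned-word′ [] _ w≡s _ = ⊥-elim (<⇒≢ 1≤s w≡s)
      spanned-word′ (y ∷ ys) (acc rs) w≡s w∈Λ =
        spanned-cong (λ x → cong (λ z → coeff ((ℤ+ 1 , z) ∷ []) x) w≡)
          (spanned-factorised factors≡s (subst (All (_∈ Λ)) w≡ w∈Λ)
            (λ t t≺ t≡s t∈Λ → spanned-word′ t (rs (subst (value t <_) (cong value (sym w≡))
                                                     (≺⇒value< t _ (trans t≡s (sym factors≡s)) t∈Λ t≺))) t≡s t∈Λ))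
        where
        open LyndonFactorisation (factorise y ys)
        open FromFactorisation Λ x₀ p₁ lyn L R R-below
        factors≡s : length ((x₀ ∷ p₁) ++ (Period.window x₀ p₁ 0 L ++ R)) ≡ s
        factors≡s = trans (cong length (sym w≡)) w≡s

    spanned-word : ∀ w → length w ≡ s → Spanned ((ℤ+ 1 , w) ∷ [])
    spanned-word w w≡s = OverAlphabet.spanned-word′ w w (<-wellFounded _) w≡s (All.tabulate (λ x∈w → x∈w))

    spanned : ∀ f → All HomogeneousTerm f → Spanned f
    spanned [] [] = spanned-[]
    spanned ((c , w) ∷ f) (w≡s ∷ f-homogeneous) =
      spanned-++ (spanned-cong (coeff-single c w) (spanned-· c (spanned-word w w≡s))) (spanned f f-homogeneous)

open import Defs
open import Data.Nat using (ℕ; _<_; _≤_; _+_)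
open import Data.Nat.Divisibility using (_∣_)
open import Data.Nat.Primality using (Prime)
open import Data.Integer using (ℤ) renaming (+_ to ℤ+_)
open import Data.Product using (_×_; _,_; Σ-syntax; proj₁; proj₂)
open import Data.List using (List; _++_; length)
open import Data.List.Relation.Unary.All using (All)

proposition8p1 : ∀ {a ℓ : Level} {X : Set a} {_≺_ : Rel X ℓ}
    (sto : IsStrictTotalOrder _≡_ _≺_) → X →
    (s : ℕ) → 1 ≤ s →
    (r : ℕ) → 1 ≤ r → (∀ p → Prime p → p ∣ r → s < p) →
    (f : Sh.FreeZ sto) →
    All (λ cw → length (proj₂ cw) ≡ s) f →
    Σ[ lyn ∈ Sh.FreeZ sto ]
    Σ[ dec ∈ List (ℤ × Sh.Word sto × Sh.Word sto) ]
    Σ[ z ∈ Sh.FreeZ sto ]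
      All (λ cw → Sh.Lyndon sto (proj₂ cw) × length (proj₂ cw) ≡ s) lyn
      × All (λ duv → Sh.NonEmpty sto (proj₁ (proj₂ duv)) × Sh.NonEmpty sto (proj₂ (proj₂ duv))
                     × length (proj₁ (proj₂ duv)) + length (proj₂ (proj₂ duv)) ≡ s) dec
      × All (λ cw → length (proj₂ cw) ≡ s) z
      × Sh._≈_ sto f (lyn ++ (Sh.shSum sto dec ++ Sh._·_ sto (ℤ+ r) z))
proposition8p1 sto _ s 1≤s r _ r-rough f f-homogeneous = lyn , dec , z , lyn-terms , dec-terms , z-terms , f≈
  where open Span.Spanning.Spanned (Reduction.Reduce.spanned sto s r 1≤s r-rough f f-homogeneous)
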